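{- Let $\lambda$ be a Young diagram, $m_1,m_2$ minimal with $\lambda\subseteq[m_1]\times[m_2]$, $\underline d=(d_{m_1-1},\dots,d_{1-m_2})\in\mathbb N^{m_1+m_2-1}$ and $k\in\mathbb N$. Suppose that either (a) $\ell\ge0$ and the $\ell$th and $(\ell+1)$th diagonals of $\lambda$ have the same number of boxes, or (b) $\ell\le0$ and the $\ell$th and $(\ell-1)$th diagonals of $\lambda$ have the same number of boxes. In case (a), if $d_\ell=d_{\ell+1}$ (in case (b), if $d_\ell=d_{\ell-1}$), then the restricted order polytopes $\mathcal O(\lambda)^k_{\underline d}$ and $\mathcal O(\lambda\setminus\ell)^k_{\underline d\setminus\ell}$ are integrally equivalent. Moreover, in case (a), if $d_{\ell+1}<d_\ell$ (in case (b), if $d_{\ell-1}<d_\ell$), then $\mathcal O(\lambda)^k_{\underline d}$ is empty.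
   Context: $\mathbb N=\{1,2,\dots\}$, $[n]=\{1,\dots,n\}$; $\mathbb N^2$ has the componentwise order. A Young diagram is a finite nonempty down-set $\lambda\subseteq\mathbb N^2$. $\mathbb R^\lambda$ has basis $\{e_p\}_{p\in\lambda}$. For $\ell\in\{1-m_2,\dots,m_1-1\}$ the $\ell$th diagonal of $\lambda$ is $\{(i,j)\in\lambda\mid i-j=\ell\}$. The order polytope is $\mathcal O(\lambda)=\{x\in\mathbb R^\lambda\mid 0\le x_p\le x_q\le1 \text{ for all } p\le q \text{ in } \lambda\}$, and the restricted order polytope is $\mathcal O(\lambda)^k_{\underline d}=\{x\in k\mathcal O(\lambda)\mid \sum_{i-j=\ell'}x_{(i,j)}=d_{\ell'} \text{ for all } \ell'\}$. The Young diagram with diagonal $\ell$ removed: in case (a), $\lambda\setminus\ell=\{(i,j)\in\lambda\mid i-j<\ell\}\cup\{(i-1,j)\mid (i,j)\in\lambda,\ i-j>\ell\}$; in case (b), $\lambda\setminus\ell=\{(i,j)\in\lambda\mid i-j>\ell\}\cup\{(i,j-1)\mid (i,j)\in\lambda,\ i-j<\ell\}$. The vector $\underline d\setminus\ell=(d_{m_1-1},\dots,d_{\ell+1},d_{\ell-1},\dots,d_{1-m_2})$ (entry $d_\ell$ deleted) is regarded as the vector indexed by the diagonals of $\lambda\setminus\ell$ in the same order (from $m'_1-1$ down to $1-m'_2$, where $m'_1,m'_2$ are minimal with $\lambda\setminus\ell\subseteq[m'_1]\times[m'_2]$). Two polytopes $P\subset\mathbb R^m$, $Q\subset\mathbb R^n$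 are integrally equivalent if there is an affine map $f:\mathbb R^m\to\mathbb R^n$ restricting to a bijection from the affine hull of $P$ onto that of $Q$ which maps the lattice points of the former bijectively onto those of the latter and satisfies $f(P)=Q$.
   Formalization: The restricted order polytopes, their affine hulls, emptiness and the affine map of integral equivalence are taken over ℚ, with points in ℚ^λ in place of $\mathbb R^\lambda$. -}

module Defs where

open import Data.Nat as ℕ using (ℕ; zero; suc)
open import Data.Integer as ℤ using (ℤ; +_)
open import Data.Rational as ℚ using (ℚ; 0ℚ; 1ℚ)
open import Data.Fin as Fin using (Fin; toℕ)
open import Data.List using (List; []; _∷_; map; concatMap; allFin; foldr; length)
open import Data.List.Relation.Unary.All using (All)
open import Data.Product using (Σ; ∃; _×_; _,_; proj₁; proj₂)
open import Data.Bool using (if_then_else_)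
open import Relation.Nullary using (¬_; does)
open import Relation.Binary.PropositionalEquality using (_≡_)
open import Function.Bundles using (_⇔_)
import Data.Nat.ListAction

-- Row i (1-based, i ∈ [m₁]) has length row (i-1) ≥ 1; rows weakly decrease.
-- Box (i,j) ∈ λ  iff  1 ≤ i ≤ m₁ and 1 ≤ j ≤ row (i-1).
-- Then m₁ = number of rows and m₂ = length of the first row are exactly the
-- minimal numbers with λ ⊆ [m₁]×[m₂].

record YD : Set where
  field
    n₁   : ℕ                      -- m₁ = suc n₁  (λ nonempty)
    row  : Fin (suc n₁) → ℕ
    pos  : ∀ i → 1 ℕ.≤ row i
    anti : ∀ i j → i Fin.≤ j → row j ℕ.≤ row i

open YD public

m₁ : YD → ℕ
m₁ Y = suc (n₁ Y)

m₂ : YD → ℕ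
m₂ Y = row Y Fin.zero

Box : YD → Set
Box Y = Σ (Fin (m₁ Y)) (λ i → Fin (row Y i))

coord : {Y : YD} → Box Y → ℕ × ℕ
coord (i , j) = suc (toℕ i) , suc (toℕ j)

_∋_ : YD → ℕ × ℕ → Set
Y ∋ p = ∃ λ (b : Box Y) → coord {Y} b ≡ p

_≤ᵇ_ : {Y : YD} → Box Y → Box Y → Set
_≤ᵇ_ {Y} b c = (proj₁ (coord {Y} b) ℕ.≤ proj₁ (coord {Y} c))
             × (proj₂ (coord {Y} b) ℕ.≤ proj₂ (coord {Y} c))

diag : {Y : YD} → Box Y → ℤ
diag {Y} b = (+ proj₁ (coord {Y} b)) ℤ.- (+ proj₂ (coord {Y} b))

boxes : (Y : YD) → List (Box Y)
boxes Y = concatMap (λ i → map (λ j → (i , j)) (allFin (row Y i))) (allFin (m₁ Y))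

sumℚ : List ℚ → ℚ
sumℚ = foldr ℚ._+_ 0ℚ

ΣBox : (Y : YD) → (Box Y → ℚ) → ℚ
ΣBox Y g = sumℚ (map g (boxes Y))

diagCount : YD → ℤ → ℕ
diagCount Y ℓ' = Data.Nat.ListAction.sum (map (λ b → if does (diag {Y} b ℤ.≟ ℓ') then 1 else 0) (boxes Y))

diagSum : (Y : YD) → (Box Y → ℚ) → ℤ → ℚ
diagSum Y x ℓ' = ΣBox Y (λ b → if does (diag {Y} b ℤ.≟ ℓ') then x b else 0ℚ)

ℕtoℚ : ℕ → ℚ
ℕtoℚ n = (+ n) ℚ./ 1

OrderPolytope : (Y : YD) → (Box Y → ℚ) → Set
OrderPolytope Y x = ∀ (p q : Box Y) → _≤ᵇ_ {Y} p q →
  (0ℚ ℚ.≤ x p) × (x p ℚ.≤ x q) × (x q ℚ.≤ 1ℚ)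

DilatedOP : (Y : YD) → ℕ → (Box Y → ℚ) → Set
DilatedOP Y k x = ∃ λ (y : Box Y → ℚ) → OrderPolytope Y y × (∀ p → x p ≡ ℕtoℚ k ℚ.* y p)

-- entry of a list (0-based), default 0
nth : List ℕ → ℕ → ℕ
nth []       _       = 0
nth (a ∷ as) zero    = a
nth (a ∷ as) (suc t) = nth as t

del : List ℕ → ℕ → List ℕ
del []       _       = []
del (a ∷ as) zero    = as
del (a ∷ as) (suc t) = a ∷ del as t

-- d = (d_{m₁-1}, …, d_{1-m₂}) is a list; diagonal ℓ' sits at position m₁-1-ℓ'
diagPos : YD → ℤ → ℕ
diagPos Y ℓ' = ℤ.∣ (+ (m₁ Y ℕ.∸ 1)) ℤ.- ℓ' ∣

dAt : YD → List ℕ → ℤ → ℕ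
dAt Y d ℓ' = nth d (diagPos Y ℓ')

RestrictedOP : (Y : YD) → ℕ → List ℕ → (Box Y → ℚ) → Set
RestrictedOP Y k d x = DilatedOP Y k x ×
  (∀ t → t ℕ.< m₁ Y ℕ.+ m₂ Y ℕ.∸ 1 →
     diagSum Y x ((+ (m₁ Y ℕ.∸ 1)) ℤ.- (+ t)) ≡ ℕtoℚ (nth d t))

-- Young diagram with diagonal ℓ removed, as a set of pairs.

RemovedA : YD → ℤ → ℕ × ℕ → Set
RemovedA Y ℓ (i , j) =
  (Y ∋ (i , j) × ((+ i) ℤ.- (+ j)) ℤ.< ℓ)
  Data.Sum.⊎ (Y ∋ (suc i , j) × ℓ ℤ.< ((+ suc i) ℤ.- (+ j)))
  where import Data.Sum

RemovedB : YD → ℤ → ℕ × ℕ → Set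
RemovedB Y ℓ (i , j) =
  (Y ∋ (i , j) × ℓ ℤ.< ((+ i) ℤ.- (+ j)))
  Data.Sum.⊎ (Y ∋ (i , suc j) × ((+ i) ℤ.- (+ suc j)) ℤ.< ℓ)
  where import Data.Sum

HasBoxes : YD → (ℕ × ℕ → Set) → Set
HasBoxes μ S = ∀ p → (μ ∋ p) ⇔ S p

_≐_ : {A : Set} → (A → ℚ) → (A → ℚ) → Set
x ≐ y = ∀ a → x a ≡ y a

combo : {A : Set} → List (ℚ × (A → ℚ)) → A → ℚ
combo cs a = sumℚ (map (λ cy → proj₁ cy ℚ.* proj₂ cy a) cs)

AffineHull : {A : Set} → ((A → ℚ) → Set) → (A → ℚ) → Set
AffineHull P x = ∃ λ cs → All (λ cy → P (proj₂ cy)) cs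
  × sumℚ (map proj₁ cs) ≡ 1ℚ × x ≐ combo cs

IsIntegral : ℚ → Set
IsIntegral q = ∃ λ (z : ℤ) → q ≡ z ℚ./ 1

LatticePoint : {A : Set} → (A → ℚ) → Set
LatticePoint x = ∀ a → IsIntegral (x a)

IsAffine : (Y μ : YD) → ((Box Y → ℚ) → (Box μ → ℚ)) → Set
IsAffine Y μ f = ∃ λ (A : Box μ → Box Y → ℚ) → ∃ λ (b : Box μ → ℚ) →
  ∀ x q → f x q ≡ ΣBox Y (λ p → A q p ℚ.* x p) ℚ.+ b q

IntegrallyEquivalent : (Y μ : YD) → ((Box Y → ℚ) → Set) → ((Box μ → ℚ) → Set) → Set
IntegrallyEquivalent Y μ P Q = ∃ λ (f : (Box Y → ℚ) → (Box μ → ℚ)) →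
    IsAffine Y μ f
  × (∀ x → AffineHull P x → AffineHull Q (f x))
  × (∀ x x' → AffineHull P x → AffineHull P x' → f x ≐ f x' → x ≐ x')
  × (∀ y → AffineHull Q y → ∃ λ x → AffineHull P x × f x ≐ y)
  × (∀ x → AffineHull P x → LatticePoint x → LatticePoint (f x))
  × (∀ y → AffineHull Q y → LatticePoint y →
       ∃ λ x → AffineHull P x × LatticePoint x × f x ≐ y)
  × (∀ x → P x → Q (f x))
  × (∀ y → Q y → ∃ λ x → P x × f x ≐ y)

Empty : {A : Set} → ((A → ℚ) → Set) → Set
Empty P = ∀ x → ¬ P x

{-# OPTIONS --safe #-}
module Submission where

-- In case (a) each box (i, j) on diagonal ℓ lies below its neighbour (i + 1, j) on diagonal
-- ℓ + 1 (in case (b), (i, j + 1) on diagonal ℓ − 1); when the two diagonals have equally many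
-- boxes this is a bijection between them. Points of O(λ)^k_d are monotone, so
-- d_ℓ = Σ_{diagonal ℓ} x ≤ Σ_{neighbour diagonal} x = d_{ℓ±1}: the polytope is empty when
-- d_{ℓ±1} < d_ℓ, and when they are equal every point, hence every point of the affine hull,
-- agrees on each pair of neighbours. Then restricting x along the embedding λ∖ℓ → λ that skips
-- diagonal ℓ is the integral equivalence; its inverse copies diagonal ℓ ± 1 onto diagonal ℓ.

open import Defs
open import Algebra.Bundles using (CommutativeSemigroup)
open import Algebra.Structures using (IsCommutativeMonoid)
open import Level using (0ℓ)
open import Data.Bool using (if_then_else_)
open import Data.Empty using (⊥-elim)
open import Data.Fin as Fin using (toℕ; fromℕ<)
import Data.Fin.Properties as FinP
open import Data.Integer as ℤ using (ℤ; +_; -[1+_])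
import Data.Integer.Properties as ℤP
import Data.Nat.Coprimality as Coprimality
open import Data.Integer.Tactic.RingSolver using (solve-∀)
import Data.Nat.Tactic.RingSolver as ℕSolver
open import Data.List using (List; []; _∷_; map; concatMap; allFin; foldr; _++_; length)
open import Data.List.Relation.Unary.All as All using (All)
import Data.List.Relation.Unary.All.Properties as AllP
open import Data.List.Relation.Unary.Any using (here; there)
open import Data.List.Membership.Propositional using (_∈_)
open import Data.List.Membership.Propositional.Properties using (∈-allFin; ∈-map⁺; ∈-concat⁺′)
open import Data.List.Relation.Unary.Unique.Propositional using (Unique)
open import Data.List.Relation.Unary.Unique.Propositional.Properties using (allFin⁺)
import Data.List.Relation.Unary.AllPairs as AllPairs
open import Data.Nat as ℕ using (ℕ; zero; suc; _+_; _∸_; _≤_; _<_; z≤n; s≤s)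
import Data.Nat.Properties as ℕP
open import Data.Product using (∃; _×_; _,_; proj₁; proj₂)
open import Data.Product.Properties using (≡-dec)
open import Data.Rational as ℚ using (ℚ; 0ℚ; 1ℚ)
import Data.Rational.Properties as ℚP
open import Data.Sum using (_⊎_; inj₁; inj₂; [_,_]′)
import Data.Sum
open import Function using (_∘_; _⇔_; Equivalence; mk⇔)
open import Function.Properties.Equivalence using () renaming (trans to ⇔-trans)
open import Relation.Binary.Definitions using (DecidableEquality; Tri; tri<; tri≈; tri>)
open import Relation.Nullary using (¬_; Dec; yes; no; does; _×-dec_; ¬?)
open import Relation.Nullary.Decidable using (toSum)
open import Relation.Binary.PropositionalEquality

module ListSum {A : Set} {_⊕_ : A → A → A} {ε : A} (isCM : IsCommutativeMonoid _≡_ _⊕_ ε) where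

  open IsCommutativeMonoid isCM using (assoc; identityˡ; identityʳ; isCommutativeSemigroup)
  private
    commutativeSemigroup : CommutativeSemigroup 0ℓ 0ℓ
    commutativeSemigroup = record { isCommutativeSemigroup = isCommutativeSemigroup }

  open import Algebra.Properties.CommutativeSemigroup commutativeSemigroup using (interchange)

  sumMap : {X : Set} → (X → A) → List X → A
  sumMap f xs = foldr _⊕_ ε (map f xs)

  sumMap-cong-∈ : {X : Set} {f g : X → A} (xs : List X) → (∀ x → x ∈ xs → f x ≡ g x) →
                  sumMap f xs ≡ sumMap g xs
  sumMap-cong-∈ []       h = refl
  sumMap-cong-∈ (x ∷ xs) h = cong₂ _⊕_ (h x (here refl)) (sumMap-cong-∈ xs (λ y → h y ∘ there))

  sumMap-cong : {X : Set} {f g : X → A} (xs : List X) → (∀ x → f x ≡ g x) → sumMap f xs ≡ sumMap g xs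
  sumMap-cong xs h = sumMap-cong-∈ xs (λ x _ → h x)

  sumMap-ε : {X : Set} {f : X → A} (xs : List X) → (∀ x → x ∈ xs → f x ≡ ε) → sumMap f xs ≡ ε
  sumMap-ε []       h = refl
  sumMap-ε (x ∷ xs) h = trans (cong₂ _⊕_ (h x (here refl)) (sumMap-ε xs (λ y → h y ∘ there))) (identityˡ ε)

  sumMap-⊕ : {X : Set} (f g : X → A) (xs : List X) →
             sumMap (λ x → f x ⊕ g x) xs ≡ sumMap f xs ⊕ sumMap g xs
  sumMap-⊕ f g []       = sym (identityˡ ε)
  sumMap-⊕ f g (x ∷ xs) = trans (cong ((f x ⊕ g x) ⊕_) (sumMap-⊕ f g xs)) (interchange (f x) (g x) _ _)

  sumMap-comm : {X Z : Set} (w : X → Z → A) (xs : List X) (zs : List Z) →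
                sumMap (λ x → sumMap (w x) zs) xs ≡ sumMap (λ z → sumMap (λ x → w x z) xs) zs
  sumMap-comm w []       zs = sym (sumMap-ε zs (λ _ _ → refl))
  sumMap-comm w (x ∷ xs) zs = trans (cong (sumMap (w x) zs ⊕_) (sumMap-comm w xs zs))
                                    (sym (sumMap-⊕ (w x) (λ z → sumMap (λ x → w x z) xs) zs))

  sumMap-map : {X Z : Set} (f : Z → A) (h : X → Z) (xs : List X) → sumMap f (map h xs) ≡ sumMap (f ∘ h) xs
  sumMap-map f h []       = refl
  sumMap-map f h (x ∷ xs) = cong (f (h x) ⊕_) (sumMap-map f h xs)

  sumMap-++ : {X : Set} (f : X → A) (xs ys : List X) → sumMap f (xs ++ ys) ≡ sumMap f xs ⊕ sumMap f ys
  sumMap-++ f []       ys = sym (identityˡ _)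
  sumMap-++ f (x ∷ xs) ys = trans (cong (f x ⊕_) (sumMap-++ f xs ys)) (sym (assoc _ _ _))

  sumMap-concatMap : {X Z : Set} (f : Z → A) (h : X → List Z) (xs : List X) →
                     sumMap f (concatMap h xs) ≡ sumMap (λ x → sumMap f (h x)) xs
  sumMap-concatMap f h []       = refl
  sumMap-concatMap f h (x ∷ xs) = trans (sumMap-++ f (h x) (concatMap h xs))
                                        (cong (sumMap f (h x) ⊕_) (sumMap-concatMap f h xs))

  sumMap-unique : {X : Set} (f : X → A) {xs : List X} {c : X} → Unique xs → c ∈ xs →
                  (∀ x → x ≢ c → f x ≡ ε) → sumMap f xs ≡ f c
  sumMap-unique f {x ∷ xs} (x∉xs AllPairs.∷ _) (here refl) h =
    trans (cong (f x ⊕_) (sumMap-ε xs (λ y y∈xs → h y (≢-sym (All.lookup x∉xs y∈xs))))) (identityʳ _)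
  sumMap-unique f {x ∷ xs} (x∉xs AllPairs.∷ u) (there c∈xs) h =
    trans (cong₂ _⊕_ (h x (All.lookup x∉xs c∈xs)) (sumMap-unique f u c∈xs h)) (identityˡ _)

_≟ᵇ_ : {Y : YD} → DecidableEquality (Box Y)
_≟ᵇ_ = ≡-dec Fin._≟_ Fin._≟_

∈-boxes : (Y : YD) (b : Box Y) → b ∈ boxes Y
∈-boxes Y (i , j) = ∈-concat⁺′ (∈-map⁺ (i ,_) (∈-allFin j))
                               (∈-map⁺ (λ i → map (i ,_) (allFin (row Y i))) (∈-allFin i))

if-does : {A P : Set} (d : Dec P) {x y z : A} → (P → x ≡ z) → (¬ P → y ≡ z) → (if does d then x else y) ≡ z
if-does (yes p) on off = on p
if-does (no ¬p) on off = off ¬p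

module BoxSum {A : Set} {_⊕_ : A → A → A} {ε : A} (isCM : IsCommutativeMonoid _≡_ _⊕_ ε) where

  open ListSum isCM public

  sumBoxes : (Y : YD) → (Box Y → A) → A
  sumBoxes Y f = sumMap f (boxes Y)

  sumBoxes-cong : (Y : YD) {f g : Box Y → A} → (∀ b → f b ≡ g b) → sumBoxes Y f ≡ sumBoxes Y g
  sumBoxes-cong Y = sumMap-cong (boxes Y)

  sumBoxes-ε : (Y : YD) {f : Box Y → A} → (∀ b → f b ≡ ε) → sumBoxes Y f ≡ ε
  sumBoxes-ε Y h = sumMap-ε (boxes Y) (λ b _ → h b)

  sumBoxes-single : (Y : YD) (f : Box Y → A) (c : Box Y) → (∀ b → b ≢ c → f b ≡ ε) → sumBoxes Y f ≡ f c
  sumBoxes-single Y f (c₁ , c₂) h = begin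
    sumBoxes Y f
      ≡⟨ sumMap-concatMap f (λ i → map (i ,_) (allFin (row Y i))) (allFin (m₁ Y)) ⟩
    sumMap (λ i → sumMap f (map (i ,_) (allFin (row Y i)))) (allFin (m₁ Y))
      ≡⟨ sumMap-cong (allFin (m₁ Y)) (λ i → sumMap-map f (i ,_) (allFin (row Y i))) ⟩
    sumMap (λ i → sumMap (λ j → f (i , j)) (allFin (row Y i))) (allFin (m₁ Y))
      ≡⟨ sumMap-unique (λ i → sumMap (λ j → f (i , j)) (allFin (row Y i))) (allFin⁺ _) (∈-allFin c₁) (λ i i≢c₁ →
           sumMap-ε (allFin (row Y i)) (λ j _ → h (i , j) (i≢c₁ ∘ cong proj₁))) ⟩
    sumMap (λ j → f (c₁ , j)) (allFin (row Y c₁))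
      ≡⟨ sumMap-unique (λ j → f (c₁ , j)) (allFin⁺ _) (∈-allFin c₂) (λ j j≢c₂ → h (c₁ , j) (λ { refl → j≢c₂ refl })) ⟩
    f (c₁ , c₂) ∎
    where open ≡-Reasoning

  -- Both sides equal the double sum of [φ a ≡ b and ψ b ≡ a] · u a over pairs of boxes.
  sumBoxes-reindex : (Y Z : YD) (φ : Box Y → Box Z) (ψ : Box Z → Box Y) (u : Box Y → A) (v : Box Z → A) →
    (∀ a → u a ≡ ε ⊎ (ψ (φ a) ≡ a × v (φ a) ≡ u a)) →
    (∀ b → v b ≡ ε ⊎ (φ (ψ b) ≡ b × u (ψ b) ≡ v b)) →
    sumBoxes Y u ≡ sumBoxes Z v
  sumBoxes-reindex Y Z φ ψ u v hu hv =
    trans (sumBoxes-cong Y (sym ∘ rows)) (trans (sumMap-comm w (boxes Y) (boxes Z)) (sumBoxes-cong Z columns))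
    where
    match? : ∀ a b → Dec (φ a ≡ b × ψ b ≡ a)
    match? a b = _≟ᵇ_ {Z} (φ a) b ×-dec _≟ᵇ_ {Y} (ψ b) a

    w : Box Y → Box Z → A
    w a b = if does (match? a b) then u a else ε

    w-on : ∀ {a b} → φ a ≡ b → ψ b ≡ a → w a b ≡ u a
    w-on {a} {b} e e′ = if-does (match? a b) (λ _ → refl) (λ n → ⊥-elim (n (e , e′)))

    w-off : ∀ {a b} → ¬ (φ a ≡ b × ψ b ≡ a) → w a b ≡ ε
    w-off {a} {b} n = if-does (match? a b) (⊥-elim ∘ n) (λ _ → refl)

    rows : ∀ a → sumBoxes Z (w a) ≡ u a
    rows a with hu a
    ... | inj₁ uε = trans (sumBoxes-ε Z (λ b → if-does (match? a b) (λ _ → uε) (λ _ → refl))) (sym uε)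
    ... | inj₂ (ψφ , _) =
      trans (sumBoxes-single Z (w a) (φ a) (λ b b≢ → w-off (λ (e , _) → b≢ (sym e)))) (w-on refl ψφ)

    columns : ∀ b → sumBoxes Y (λ a → w a b) ≡ v b
    columns b with hv b
    ... | inj₁ vε = trans (sumBoxes-ε Y (λ a → if-does (match? a b) (onColumn a) (λ _ → refl))) (sym vε)
      where
      onColumn : ∀ a → φ a ≡ b × ψ b ≡ a → u a ≡ ε
      onColumn a (refl , _) with hu a
      ... | inj₁ uε          = uε
      ... | inj₂ (_ , vφ≡u) = trans (sym vφ≡u) vε
    ... | inj₂ (φψ , u≡v) =
      trans (sumBoxes-single Y (λ a → w a b) (ψ b) (λ a a≢ → w-off (λ (_ , e) → a≢ (sym e)))) (trans (w-on φψ refl) u≡v)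

private
  add-sub : ∀ x w → (x ℤ.+ w) ℤ.- w ≡ x
  add-sub = solve-∀

  difference-shift : ∀ m n p → (+ m ℤ.- + n) ℤ.+ (+ n ℤ.+ + p) ≡ + (m + p)
  difference-shift m n p = trans (lemma (+ m) (+ n) (+ p)) (sym (ℤP.pos-+ m p))
    where
    lemma : ∀ a b c → (a ℤ.- b) ℤ.+ (b ℤ.+ c) ≡ a ℤ.+ c
    lemma = solve-∀

  difference-shift′ : ∀ m n p → (+ m ℤ.- + n) ℤ.+ (+ p ℤ.+ + n) ≡ + (m + p)
  difference-shift′ m n p = trans (cong (λ w → (+ m ℤ.- + n) ℤ.+ w) (ℤP.+-comm (+ p) (+ n))) (difference-shift m n p)

m-n≡o-p⇒m+p≡o+n : ∀ m n o p → + m ℤ.- + n ≡ + o ℤ.- + p → m + p ≡ o + n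
m-n≡o-p⇒m+p≡o+n m n o p eq = ℤP.+-injective (begin
  + (m + p)                               ≡⟨ difference-shift m n p ⟨
  (+ m ℤ.- + n) ℤ.+ (+ n ℤ.+ + p)         ≡⟨ cong (ℤ._+ (+ n ℤ.+ + p)) eq ⟩
  (+ o ℤ.- + p) ℤ.+ (+ n ℤ.+ + p)         ≡⟨ difference-shift′ o p n ⟩
  + (o + n)                               ∎)
  where open ≡-Reasoning

m+p≡o+n⇒m-n≡o-p : ∀ m n o p → m + p ≡ o + n → + m ℤ.- + n ≡ + o ℤ.- + p
m+p≡o+n⇒m-n≡o-p m n o p eq = begin
  + m ℤ.- + n                                        ≡⟨ add-sub _ w ⟨
  ((+ m ℤ.- + n) ℤ.+ w) ℤ.- w                        ≡⟨ cong (ℤ._- w) shifted ⟩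
  ((+ o ℤ.- + p) ℤ.+ w) ℤ.- w                        ≡⟨ add-sub _ w ⟩
  + o ℤ.- + p                                        ∎
  where
  open ≡-Reasoning
  w : ℤ
  w = + n ℤ.+ + p
  shifted : (+ m ℤ.- + n) ℤ.+ w ≡ (+ o ℤ.- + p) ℤ.+ w
  shifted = trans (difference-shift m n p) (trans (cong +_ eq) (sym (difference-shift′ o p n)))

m-n<o-p⇒m+p<o+n : ∀ m n o p → + m ℤ.- + n ℤ.< + o ℤ.- + p → m + p < o + n
m-n<o-p⇒m+p<o+n m n o p lt = ℤP.drop‿+<+
  (subst₂ ℤ._<_ (difference-shift m n p) (difference-shift′ o p n) (ℤP.+-monoˡ-< (+ n ℤ.+ + p) lt))

m+p<o+n⇒m-n<o-p : ∀ m n o p → m + p < o + n → + m ℤ.- + n ℤ.< + o ℤ.- + p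
m+p<o+n⇒m-n<o-p m n o p lt = subst₂ ℤ._<_ (add-sub _ w) (add-sub _ w) (ℤP.+-monoˡ-< (ℤ.- w)
  (subst₂ ℤ._<_ (sym (difference-shift m n p)) (sym (difference-shift′ o p n)) (ℤ.+<+ lt)))
  where
  w : ℤ
  w = + n ℤ.+ + p

∣m-n∣≡m∸n : ∀ {m n} → n ≤ m → ℤ.∣ + m ℤ.- + n ∣ ≡ m ∸ n
∣m-n∣≡m∸n {m} {n} n≤m = cong ℤ.∣_∣ (trans (ℤP.m-n≡m⊖n m n) (ℤP.⊖-≥ n≤m))

private
  ℕtoℚ≡mkℚ : ∀ n → ℕtoℚ n ≡ ℚ.mkℚ (+ n) 0 (Coprimality.sym (Coprimality.1-coprimeTo n))
  ℕtoℚ≡mkℚ n = ℚP.normalize-coprime (Coprimality.sym (Coprimality.1-coprimeTo n))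

ℕtoℚ-cancel-≤ : ∀ {m n} → ℕtoℚ m ℚ.≤ ℕtoℚ n → m ≤ n
ℕtoℚ-cancel-≤ {m} {n} le rewrite ℕtoℚ≡mkℚ m | ℕtoℚ≡mkℚ n =
  ℤP.drop‿+≤+ (subst₂ ℤ._≤_ (ℤP.*-identityʳ (+ m)) (ℤP.*-identityʳ (+ n)) (ℚP.drop-*≤* le))

ℕtoℚ-*-cancelˡ-≡ : ∀ k → 1 ≤ k → ∀ {a b} → ℕtoℚ k ℚ.* a ≡ ℕtoℚ k ℚ.* b → a ≡ b
ℕtoℚ-*-cancelˡ-≡ (suc k) _ e = ℚP.≤-antisym (cancel (ℚP.≤-reflexive e)) (cancel (ℚP.≤-reflexive (sym e)))
  where
  cancel : ∀ {a b} → ℕtoℚ (suc k) ℚ.* a ℚ.≤ ℕtoℚ (suc k) ℚ.* b → a ℚ.≤ b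
  cancel = ℚP.*-cancelˡ-≤-pos (ℕtoℚ (suc k)) {{ℚP.normalize-pos (suc k) 1}}

ℕtoℚ-*-monoʳ-≤ : ∀ k {a b} → a ℚ.≤ b → ℕtoℚ k ℚ.* a ℚ.≤ ℕtoℚ k ℚ.* b
ℕtoℚ-*-monoʳ-≤ k = ℚP.*-monoˡ-≤-nonNeg (ℕtoℚ k) {{ℚP.normalize-nonNeg k 1}}

punchIn : ℕ → ℕ → ℕ
punchIn zero    t       = suc t
punchIn (suc i) zero    = zero
punchIn (suc i) (suc t) = suc (punchIn i t)

nth-del : ∀ d i t → nth (del d i) t ≡ nth d (punchIn i t)
nth-del []      zero    t       = refl
nth-del []      (suc i) zero    = refl
nth-del []      (suc i) (suc t) = refl
nth-del (a ∷ d) zero    t       = refl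
nth-del (a ∷ d) (suc i) zero    = refl
nth-del (a ∷ d) (suc i) (suc t) = nth-del d i t

punchIn-fixed : ∀ {i t} → t < i → punchIn i t ≡ t
punchIn-fixed {suc i} {zero}  _         = refl
punchIn-fixed {suc i} {suc t} (s≤s t<i) = cong suc (punchIn-fixed t<i)

punchIn-shifted : ∀ {i t} → i ≤ t → punchIn i t ≡ suc t
punchIn-shifted {zero}  {t}     _         = refl
punchIn-shifted {suc i} {suc t} (s≤s i≤t) = cong suc (punchIn-shifted i≤t)

punchIn≢ : ∀ i t → punchIn i t ≢ i
punchIn≢ zero    t       ()
punchIn≢ (suc i) zero    ()
punchIn≢ (suc i) (suc t) e = punchIn≢ i t (ℕP.suc-injective e)

punchIn-injective : ∀ i {s t} → punchIn i s ≡ punchIn i t → s ≡ t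
punchIn-injective zero    {s}     {t}     e = ℕP.suc-injective e
punchIn-injective (suc i) {zero}  {zero}  e = refl
punchIn-injective (suc i) {suc s} {suc t} e = cong suc (punchIn-injective i (ℕP.suc-injective e))

punchIn-bounded : ∀ i {t n} → t < n → punchIn i t < suc n
punchIn-bounded i {t} {n} t<n with t ℕ.<? i
... | yes t<i = ℕP.m<n⇒m<1+n (subst (_< n) (sym (punchIn-fixed t<i)) t<n)
... | no  t≮i = subst (_< suc n) (sym (punchIn-shifted (ℕP.≮⇒≥ t≮i))) (s≤s t<n)

punchIn-surjective : ∀ {i t′ n} → i < suc n → t′ < suc n → t′ ≢ i → ∃ λ t → punchIn i t ≡ t′ × t < n
punchIn-surjective {i} {t′} {n} i<1+n t′<1+n t′≢i with ℕP.<-cmp t′ i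
... | tri< t′<i _ _ = t′ , punchIn-fixed t′<i , ℕP.<-≤-trans t′<i (ℕP.≤-pred i<1+n)
... | tri≈ _ t′≡i _ = ⊥-elim (t′≢i t′≡i)
punchIn-surjective {i} {suc t} {n} _ (s≤s t<n) _ | tri> _ _ (s≤s i≤t) = t , punchIn-shifted i≤t , t<n

rowOf colOf : (Y : YD) → Box Y → ℕ
rowOf Y p = proj₁ (coord {Y} p)
colOf Y p = proj₂ (coord {Y} p)

box-injective : (Y : YD) {p q : Box Y} → rowOf Y p ≡ rowOf Y q → colOf Y p ≡ colOf Y q → p ≡ q
box-injective Y {i , j} {i′ , j′} e e′ with FinP.toℕ-injective (ℕP.suc-injective e)
... | refl with FinP.toℕ-injective (ℕP.suc-injective e′)
... | refl = refl

nDiag : YD → ℕ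
nDiag Y = m₁ Y + m₂ Y ∸ 1

diagAt : YD → ℕ → ℤ
diagAt Y t = + (m₁ Y ∸ 1) ℤ.- + t

diagAt-injective : ∀ Y {s t} → diagAt Y s ≡ diagAt Y t → s ≡ t
diagAt-injective Y {s} {t} e = sym (ℕP.+-cancelˡ-≡ (n₁ Y) _ _ (m-n≡o-p⇒m+p≡o+n (n₁ Y) s (n₁ Y) t e))

diagIndex : (Y : YD) → Box Y → ℕ
diagIndex Y p = (n₁ Y + colOf Y p) ∸ rowOf Y p

rowOf+diagIndex : (Y : YD) (p : Box Y) → rowOf Y p + diagIndex Y p ≡ n₁ Y + colOf Y p
rowOf+diagIndex Y (i , j) = ℕP.m+[n∸m]≡n (subst (suc (toℕ i) ≤_) (sym (ℕP.+-suc (n₁ Y) (toℕ j)))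
  (ℕP.≤-trans (FinP.toℕ<n i) (ℕP.m≤m+n (suc (n₁ Y)) (toℕ j))))

diag≡diagAt⇒diagIndex≡ : (Y : YD) (p : Box Y) {t : ℕ} → diag {Y} p ≡ diagAt Y t → diagIndex Y p ≡ t
diag≡diagAt⇒diagIndex≡ Y p {t} e = ℕP.+-cancelˡ-≡ (rowOf Y p) _ _
  (trans (rowOf+diagIndex Y p) (sym (m-n≡o-p⇒m+p≡o+n (rowOf Y p) (colOf Y p) (n₁ Y) t e)))

diagIndex≡⇒diag≡diagAt : (Y : YD) (p : Box Y) {t : ℕ} → diagIndex Y p ≡ t → diag {Y} p ≡ diagAt Y t
diagIndex≡⇒diag≡diagAt Y p {t} refl = m+p≡o+n⇒m-n≡o-p (rowOf Y p) (colOf Y p) (n₁ Y) t (rowOf+diagIndex Y p)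

module ℚSum = BoxSum ℚP.+-0-isCommutativeMonoid
module ℕSum = BoxSum ℕP.+-0-isCommutativeMonoid

open ℚSum using (sumMap; sumBoxes)

+-≤-≡⇒≡ : ∀ {a b c d : ℚ} → a ℚ.≤ b → c ℚ.≤ d → a ℚ.+ c ≡ b ℚ.+ d → a ≡ b × c ≡ d
+-≤-≡⇒≡ {a} {b} {c} {d} a≤b c≤d e = a≡b , ∙-cancelˡ a c d (subst (λ z → a ℚ.+ c ≡ z ℚ.+ d) (sym a≡b) e)
  where
  open import Algebra.Properties.Group ℚP.+-0-group using (∙-cancelˡ)
  a≡b : a ≡ b
  a≡b = ℚP.≤-antisym a≤b (ℚP.≮⇒≥ (λ a<b → ℚP.<-irrefl e (ℚP.+-mono-<-≤ a<b c≤d)))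

sumMap-mono-≤ : {X : Set} {f g : X → ℚ} (xs : List X) → (∀ x → f x ℚ.≤ g x) → sumMap f xs ℚ.≤ sumMap g xs
sumMap-mono-≤ []       f≤g = ℚP.≤-refl
sumMap-mono-≤ (x ∷ xs) f≤g = ℚP.+-mono-≤ (f≤g x) (sumMap-mono-≤ xs f≤g)

sumMap-mono-≤-≡⇒≡ : {X : Set} {f g : X → ℚ} (xs : List X) → (∀ x → f x ℚ.≤ g x) →
                    sumMap f xs ≡ sumMap g xs → ∀ {x} → x ∈ xs → f x ≡ g x
sumMap-mono-≤-≡⇒≡ (y ∷ ys) f≤g e (here refl) = proj₁ (+-≤-≡⇒≡ (f≤g y) (sumMap-mono-≤ ys f≤g) e)
sumMap-mono-≤-≡⇒≡ (y ∷ ys) f≤g e (there x∈ys) =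
  sumMap-mono-≤-≡⇒≡ ys f≤g (proj₂ (+-≤-≡⇒≡ (f≤g y) (sumMap-mono-≤ ys f≤g) e)) x∈ys

diagSum-cong : (Y : YD) {f g : Box Y → ℚ} (δ : ℤ) → (∀ b → f b ≡ g b) → diagSum Y f δ ≡ diagSum Y g δ
diagSum-cong Y δ f≡g = ℚSum.sumBoxes-cong Y (λ b → cong (λ v → if does (diag {Y} b ℤ.≟ δ) then v else 0ℚ) (f≡g b))

restricted-mono : (Y : YD) {k : ℕ} {d : List ℕ} {x : Box Y → ℚ} → RestrictedOP Y k d x →
                  ∀ {p q} → _≤ᵇ_ {Y} p q → x p ℚ.≤ x q
restricted-mono Y {k} ((y , order , x≡ky) , _) {p} {q} p≤q =
  subst₂ ℚ._≤_ (sym (x≡ky p)) (sym (x≡ky q)) (ℕtoℚ-*-monoʳ-≤ k (proj₁ (proj₂ (order p q p≤q))))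

affineHull-reindex : {A B : Set} (s : B → A) {P : (A → ℚ) → Set} {Q : (B → ℚ) → Set} →
  (∀ y → P y → Q (y ∘ s)) → ∀ x → AffineHull P x → AffineHull Q (x ∘ s)
affineHull-reindex s {P} {Q} P⇒Q x (cs , allP , Σc≡1 , x≐) =
  map reindex cs , AllP.map⁺ (All.map (λ {cy} → P⇒Q (proj₂ cy)) allP) ,
  trans (sumMap-map proj₁ reindex cs) Σc≡1 ,
  λ b → trans (x≐ (s b)) (sym (sumMap-map (λ cy → proj₁ cy ℚ.* proj₂ cy b) reindex cs))
  where
  open ℚSum using (sumMap-map)
  reindex : ℚ × (_ → ℚ) → ℚ × (_ → ℚ)
  reindex (c , y) = c , y ∘ s

onDiagonal : (Y : YD) → ℤ → (Box Y → ℚ) → Box Y → ℚ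
onDiagonal Y δ x b = if does (diag {Y} b ℤ.≟ δ) then x b else 0ℚ

onDiagonal-on : (Y : YD) {δ : ℤ} (x : Box Y → ℚ) {b : Box Y} → diag {Y} b ≡ δ → onDiagonal Y δ x b ≡ x b
onDiagonal-on Y {δ} x {b} e = if-does (diag {Y} b ℤ.≟ δ) (λ _ → refl) (λ n → ⊥-elim (n e))

onDiagonal-off : (Y : YD) {δ : ℤ} (x : Box Y → ℚ) {b : Box Y} → diag {Y} b ≢ δ → onDiagonal Y δ x b ≡ 0ℚ
onDiagonal-off Y {δ} x {b} n = if-does (diag {Y} b ℤ.≟ δ) (⊥-elim ∘ n) (λ _ → refl)

record DiagonalMatching (Y : YD) (i i′ : ℕ) : Set where
  field
    up down   : Box Y → Box Y
    up-off    : ∀ p → diag {Y} p ≢ diagAt Y i → up p ≡ p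
    ≤-up      : ∀ p → diag {Y} p ≡ diagAt Y i → _≤ᵇ_ {Y} p (up p)
    diag-up   : ∀ p → diag {Y} p ≡ diagAt Y i → diag {Y} (up p) ≡ diagAt Y i′
    diag-down : ∀ p → diag {Y} p ≡ diagAt Y i′ → diag {Y} (down p) ≡ diagAt Y i
    up∘down   : ∀ p → diag {Y} p ≡ diagAt Y i′ → up (down p) ≡ p
    down∘up   : ∀ p → diag {Y} p ≡ diagAt Y i → down (up p) ≡ p
    i′≢i      : i′ ≢ i
    i<nDiag   : i < nDiag Y
    i′<nDiag  : i′ < nDiag Y

module DiagonalMatchingProperties {Y : YD} {i i′ : ℕ} (M : DiagonalMatching Y i i′) where

  open DiagonalMatching M

  diagSum-up : ∀ x → diagSum Y x (diagAt Y i′) ≡ diagSum Y (x ∘ up) (diagAt Y i)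
  diagSum-up x = ℚSum.sumBoxes-reindex Y Y down up _ _ toLower toUpper
    where
    lower upper : Box Y → ℚ
    lower = onDiagonal Y (diagAt Y i′) x
    upper = onDiagonal Y (diagAt Y i) (x ∘ up)

    toLower : ∀ p → lower p ≡ 0ℚ ⊎ (up (down p) ≡ p × upper (down p) ≡ lower p)
    toLower p = [ (λ e → inj₂ (up∘down p e , trans (onDiagonal-on Y (x ∘ up) (diag-down p e))
                                                  (trans (cong x (up∘down p e)) (sym (onDiagonal-on Y x e)))))
                , (λ n → inj₁ (onDiagonal-off Y x n)) ]′ (toSum (diag {Y} p ℤ.≟ diagAt Y i′))
    toUpper : ∀ p → upper p ≡ 0ℚ ⊎ (down (up p) ≡ p × lower (up p) ≡ upper p)
    toUpper p = [ (λ e → inj₂ (down∘up p e , trans (onDiagonal-on Y x (diag-up p e)) (sym (onDiagonal-on Y (x ∘ up) e))))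
                , (λ n → inj₁ (onDiagonal-off Y (x ∘ up) n)) ]′ (toSum (diag {Y} p ℤ.≟ diagAt Y i))

  module _ {k : ℕ} {d : List ℕ} {x : Box Y → ℚ} (x∈P : RestrictedOP Y k d x) where

    private
      ≤-onDiagonal-up : ∀ p → onDiagonal Y (diagAt Y i) x p ℚ.≤ onDiagonal Y (diagAt Y i) (x ∘ up) p
      ≤-onDiagonal-up p = [ (λ e → subst₂ ℚ._≤_ (sym (onDiagonal-on Y x e)) (sym (onDiagonal-on Y (x ∘ up) e))
                                                 (restricted-mono Y {k} {d} x∈P (≤-up p e)))
                          , (λ n → ℚP.≤-reflexive (trans (onDiagonal-off Y x n) (sym (onDiagonal-off Y (x ∘ up) n)))) ]′
                          (toSum (diag {Y} p ℤ.≟ diagAt Y i))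

      diagSum-i : diagSum Y x (diagAt Y i) ≡ ℕtoℚ (nth d i)
      diagSum-i = proj₂ x∈P i i<nDiag

      diagSum-up-i : diagSum Y (x ∘ up) (diagAt Y i) ≡ ℕtoℚ (nth d i′)
      diagSum-up-i = trans (sym (diagSum-up x)) (proj₂ x∈P i′ i′<nDiag)

    nth-≤ : nth d i ≤ nth d i′
    nth-≤ = ℕtoℚ-cancel-≤ (subst₂ ℚ._≤_ diagSum-i diagSum-up-i (sumMap-mono-≤ (boxes Y) ≤-onDiagonal-up))

    up-invariant : nth d i ≡ nth d i′ → ∀ p → x (up p) ≡ x p
    up-invariant eq p = [ (λ e → sym (trans (sym (onDiagonal-on Y x e))
                            (trans (sumMap-mono-≤-≡⇒≡ (boxes Y) ≤-onDiagonal-up sums-agree (∈-boxes Y p))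
                                   (onDiagonal-on Y (x ∘ up) e))))
                        , (λ n → cong x (up-off p n)) ]′ (toSum (diag {Y} p ℤ.≟ diagAt Y i))
      where
      sums-agree : diagSum Y x (diagAt Y i) ≡ diagSum Y (x ∘ up) (diagAt Y i)
      sums-agree = trans diagSum-i (trans (cong ℕtoℚ eq) (sym diagSum-up-i))

record Contraction (Y μ : YD) {i i′ : ℕ} (M : DiagonalMatching Y i i′) : Set where
  field
    embed           : Box μ → Box Y
    collapse        : Box Y → Box μ
    collapse∘embed  : ∀ q → collapse (embed q) ≡ q
    embed∘collapse  : ∀ p → embed (collapse p) ≡ DiagonalMatching.up M p
    collapse-mono   : ∀ {p p′} → _≤ᵇ_ {Y} p p′ → _≤ᵇ_ {μ} (collapse p) (collapse p′)
    embed-mono      : ∀ {q q′} → _≤ᵇ_ {μ} q q′ → _≤ᵇ_ {Y} (embed q) (embed q′) ⊎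
                        ∃ λ r → diag {Y} r ≡ diagAt Y i × _≤ᵇ_ {Y} (embed q) (DiagonalMatching.up M r)
                                                        × _≤ᵇ_ {Y} r (embed q′)
    diagIndex-embed : ∀ q → diagIndex Y (embed q) ≡ punchIn i (diagIndex μ q)
    nDiag-suc       : suc (nDiag μ) ≡ nDiag Y

module ContractionProperties {Y μ : YD} {i i′ : ℕ} {M : DiagonalMatching Y i i′} (C : Contraction Y μ M) where

  open DiagonalMatching M
  open DiagonalMatchingProperties M
  open Contraction C

  diag-embed : ∀ {t} q → diag {μ} q ≡ diagAt μ t → diag {Y} (embed q) ≡ diagAt Y (punchIn i t)
  diag-embed q e = diagIndex≡⇒diag≡diagAt Y (embed q)
    (trans (diagIndex-embed q) (cong (punchIn i) (diag≡diagAt⇒diagIndex≡ μ q e)))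

  diag-embed⁻¹ : ∀ {t} q → diag {Y} (embed q) ≡ diagAt Y (punchIn i t) → diag {μ} q ≡ diagAt μ t
  diag-embed⁻¹ q e = diagIndex≡⇒diag≡diagAt μ q
    (punchIn-injective i (trans (sym (diagIndex-embed q)) (diag≡diagAt⇒diagIndex≡ Y (embed q) e)))

  diagSum-embed : ∀ x t → diagSum μ (x ∘ embed) (diagAt μ t) ≡ diagSum Y x (diagAt Y (punchIn i t))
  diagSum-embed x t = ℚSum.sumBoxes-reindex μ Y embed collapse u v fromμ fromY
    where
    u : Box μ → ℚ
    u = onDiagonal μ (diagAt μ t) (x ∘ embed)
    v : Box Y → ℚ
    v = onDiagonal Y (diagAt Y (punchIn i t)) x

    fromμ : ∀ q → u q ≡ 0ℚ ⊎ (collapse (embed q) ≡ q × v (embed q) ≡ u q)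
    fromμ q = inj₂ (collapse∘embed q , [ (λ e → trans (onDiagonal-on Y x (diag-embed q e)) (sym (onDiagonal-on μ (x ∘ embed) e)))
                                         , (λ n → trans (onDiagonal-off Y x (n ∘ diag-embed⁻¹ q)) (sym (onDiagonal-off μ (x ∘ embed) n))) ]′
                                         (toSum (diag {μ} q ℤ.≟ diagAt μ t)))

    fromY : ∀ p → v p ≡ 0ℚ ⊎ (embed (collapse p) ≡ p × u (collapse p) ≡ v p)
    fromY p = [ on , (λ n → inj₁ (onDiagonal-off Y x n)) ]′ (toSum (diag {Y} p ℤ.≟ diagAt Y (punchIn i t)))
      where
      on : diag {Y} p ≡ diagAt Y (punchIn i t) → v p ≡ 0ℚ ⊎ (embed (collapse p) ≡ p × u (collapse p) ≡ v p)
      on e = inj₂ (embed∘collapse≡p , trans (onDiagonal-on μ (x ∘ embed) (diag-embed⁻¹ (collapse p) (trans (cong (diag {Y}) embed∘collapse≡p) e)))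
                                            (trans (cong x embed∘collapse≡p) (sym (onDiagonal-on Y x e))))
        where
        embed∘collapse≡p : embed (collapse p) ≡ p
        embed∘collapse≡p = trans (embed∘collapse p) (up-off p (λ e′ → punchIn≢ i t (diagAt-injective Y (trans (sym e) e′))))

  module _ {k : ℕ} (k≥1 : 1 ≤ k) {d : List ℕ} (d-eq : nth d i ≡ nth d i′) where

    embed-restricted : ∀ x → RestrictedOP Y k d x → RestrictedOP μ k (del d i) (x ∘ embed)
    embed-restricted x x∈P@((y , y∈O , x≡ky) , sums) = ((y ∘ embed , yμ∈O , x≡ky ∘ embed) , sumsμ)
      where
      y-up : ∀ r → y (up r) ≡ y r
      y-up r = ℕtoℚ-*-cancelˡ-≡ k k≥1 (trans (sym (x≡ky (up r))) (trans (up-invariant {k} {d} {x} x∈P d-eq r) (x≡ky r)))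

      yμ∈O : OrderPolytope μ (y ∘ embed)
      yμ∈O q q′ q≤q′ with embed-mono q≤q′
      ... | inj₁ le = y∈O (embed q) (embed q′) le
      ... | inj₂ (r , _ , q≤r , r≤q′) =
        proj₁ (y∈O _ _ q≤r) ,
        ℚP.≤-trans (proj₁ (proj₂ (y∈O _ _ q≤r))) (subst (ℚ._≤ y (embed q′)) (sym (y-up r)) (proj₁ (proj₂ (y∈O _ _ r≤q′)))) ,
        proj₂ (proj₂ (y∈O _ _ r≤q′))

      sumsμ : ∀ t → t < nDiag μ → diagSum μ (x ∘ embed) (diagAt μ t) ≡ ℕtoℚ (nth (del d i) t)
      sumsμ t t< = trans (diagSum-embed x t) (trans (sums (punchIn i t) (subst (punchIn i t <_) nDiag-suc (punchIn-bounded i t<)))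
                                                    (cong ℕtoℚ (sym (nth-del d i t))))

    collapse-restricted : ∀ z → RestrictedOP μ k (del d i) z → RestrictedOP Y k d (z ∘ collapse)
    collapse-restricted z ((w , w∈O , z≡kw) , sums) =
      ((w ∘ collapse , (λ p p′ le → w∈O _ _ (collapse-mono le)) , z≡kw ∘ collapse) , sumsY)
      where
      off-i : ∀ t′ → t′ < nDiag Y → t′ ≢ i → diagSum Y (z ∘ collapse) (diagAt Y t′) ≡ ℕtoℚ (nth d t′)
      off-i t′ t′< t′≢i with punchIn-surjective (subst (i <_) (sym nDiag-suc) i<nDiag) (subst (t′ <_) (sym nDiag-suc) t′<) t′≢i
      ... | t , refl , t< = trans (sym (diagSum-embed (z ∘ collapse) t))
        (trans (diagSum-cong μ (diagAt μ t) (λ q → cong z (collapse∘embed q))) (trans (sums t t<) (cong ℕtoℚ (nth-del d i t))))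

      collapse∘up : ∀ p → collapse (up p) ≡ collapse p
      collapse∘up p = trans (cong collapse (sym (embed∘collapse p))) (collapse∘embed (collapse p))

      sumsY : ∀ t′ → t′ < nDiag Y → diagSum Y (z ∘ collapse) (diagAt Y t′) ≡ ℕtoℚ (nth d t′)
      sumsY t′ t′< with t′ ℕ.≟ i
      ... | no  t′≢i = off-i t′ t′< t′≢i
      ... | yes refl = begin
        diagSum Y (z ∘ collapse) (diagAt Y i)        ≡⟨ diagSum-cong Y (diagAt Y i) (λ p → cong z (sym (collapse∘up p))) ⟩
        diagSum Y (z ∘ collapse ∘ up) (diagAt Y i)   ≡⟨ diagSum-up (z ∘ collapse) ⟨
        diagSum Y (z ∘ collapse) (diagAt Y i′)       ≡⟨ off-i i′ i′<nDiag i′≢i ⟩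
        ℕtoℚ (nth d i′)                              ≡⟨ cong ℕtoℚ d-eq ⟨
        ℕtoℚ (nth d i)                               ∎
        where open ≡-Reasoning

    affineHull-up-invariant : ∀ x → AffineHull (RestrictedOP Y k d) x → ∀ p → x (up p) ≡ x p
    affineHull-up-invariant x (cs , all∈P , _ , x≐) p = trans (x≐ (up p)) (trans
      (ℚSum.sumMap-cong-∈ cs (λ cy cy∈cs → cong (proj₁ cy ℚ.*_) (up-invariant {k} {d} {proj₂ cy} (All.lookup all∈P cy∈cs) d-eq p)))
      (sym (x≐ p)))

    integrallyEquivalent : IntegrallyEquivalent Y μ (RestrictedOP Y k d) (RestrictedOP μ k (del d i))
    integrallyEquivalent =
      (_∘ embed) , embed-affine ,
      affineHull-reindex embed embed-restricted ,
      injective ,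
      (λ y y∈ → y ∘ collapse , affineHull-reindex collapse collapse-restricted y y∈ , cong y ∘ collapse∘embed) ,
      (λ _ _ x-int → x-int ∘ embed) ,
      (λ y y∈ y-int → y ∘ collapse , affineHull-reindex collapse collapse-restricted y y∈ , y-int ∘ collapse ,
                      cong y ∘ collapse∘embed) ,
      embed-restricted ,
      (λ z z∈Q → z ∘ collapse , collapse-restricted z z∈Q , cong z ∘ collapse∘embed)
      where
      δ : Box μ → Box Y → ℚ
      δ q p = if does (_≟ᵇ_ {Y} p (embed q)) then 1ℚ else 0ℚ

      δ-* : ∀ q p z → δ q p ℚ.* z ≡ (if does (_≟ᵇ_ {Y} p (embed q)) then z else 0ℚ)
      δ-* q p z with _≟ᵇ_ {Y} p (embed q)
      ... | yes _ = ℚP.*-identityˡ z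
      ... | no  _ = ℚP.*-zeroˡ z

      embed-affine : IsAffine Y μ (_∘ embed)
      embed-affine = δ , (λ _ → 0ℚ) , λ x q → sym (begin
        sumBoxes Y (λ p → δ q p ℚ.* x p) ℚ.+ 0ℚ                                ≡⟨ ℚP.+-identityʳ _ ⟩
        sumBoxes Y (λ p → δ q p ℚ.* x p)                                       ≡⟨ ℚSum.sumBoxes-cong Y (λ p → δ-* q p (x p)) ⟩
        sumBoxes Y (λ p → if does (_≟ᵇ_ {Y} p (embed q)) then x p else 0ℚ)    ≡⟨ ℚSum.sumBoxes-single Y _ (embed q)
                                                                                   (λ p p≢ → if-does (_≟ᵇ_ {Y} p (embed q)) (⊥-elim ∘ p≢) (λ _ → refl)) ⟩
        (if does (_≟ᵇ_ {Y} (embed q) (embed q)) then x (embed q) else 0ℚ)     ≡⟨ if-does (_≟ᵇ_ {Y} (embed q) (embed q)) (λ _ → refl) (λ n → ⊥-elim (n refl)) ⟩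
        x (embed q)                                                            ∎)
        where open ≡-Reasoning

      injective : ∀ x x′ → AffineHull (RestrictedOP Y k d) x → AffineHull (RestrictedOP Y k d) x′ →
                  (x ∘ embed) ≐ (x′ ∘ embed) → x ≐ x′
      injective x x′ x∈ x′∈ e p = begin
        x p                   ≡⟨ affineHull-up-invariant x x∈ p ⟨
        x (up p)              ≡⟨ cong x (embed∘collapse p) ⟨
        x (embed (collapse p))  ≡⟨ e (collapse p) ⟩
        x′ (embed (collapse p)) ≡⟨ cong x′ (embed∘collapse p) ⟩
        x′ (up p)             ≡⟨ affineHull-up-invariant x′ x′∈ p ⟩
        x′ p                  ∎
        where open ≡-Reasoning

rowOf≤m₁ : (Y : YD) (p : Box Y) → rowOf Y p ≤ m₁ Y
rowOf≤m₁ Y (i , j) = FinP.toℕ<n i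

colOf≤m₂ : (Y : YD) (p : Box Y) → colOf Y p ≤ m₂ Y
colOf≤m₂ Y (i , j) = ℕP.≤-trans (FinP.toℕ<n j) (anti Y Fin.zero i z≤n)

∋-fromℕ< : (Y : YD) {a b : ℕ} (a<m₁ : a < m₁ Y) → b < row Y (fromℕ< a<m₁) → Y ∋ (suc a , suc b)
∋-fromℕ< Y a<m₁ b<row = (fromℕ< a<m₁ , fromℕ< b<row) ,
  cong₂ _,_ (cong suc (FinP.toℕ-fromℕ< a<m₁)) (cong suc (FinP.toℕ-fromℕ< b<row))

∋-down : (Y : YD) {a b a′ b′ : ℕ} → Y ∋ (a , b) → 1 ≤ a′ → 1 ≤ b′ → a′ ≤ a → b′ ≤ b → Y ∋ (a′ , b′)
∋-down Y {a′ = suc a′} {suc b′} ((i , j) , refl) _ _ (s≤s a′≤i) (s≤s b′≤j) = ∋-fromℕ< Y a′<m₁ b′<row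
  where
  a′<m₁ : a′ < m₁ Y
  a′<m₁ = ℕP.≤-<-trans a′≤i (FinP.toℕ<n i)
  b′<row : b′ < row Y (fromℕ< a′<m₁)
  b′<row = ℕP.<-≤-trans (ℕP.≤-<-trans b′≤j (FinP.toℕ<n j))
             (anti Y (fromℕ< a′<m₁) i (subst (_≤ toℕ i) (sym (FinP.toℕ-fromℕ< a′<m₁)) a′≤i))

∋-m₁,1 : (Y : YD) → Y ∋ (m₁ Y , 1)
∋-m₁,1 Y = ∋-fromℕ< Y (ℕP.n<1+n (n₁ Y)) (pos Y _)

∋-1,m₂ : (Y : YD) → Y ∋ (1 , m₂ Y)
∋-1,m₂ Y = subst (λ c → Y ∋ (1 , c)) last≡m₂ (∋-fromℕ< Y (s≤s z≤n) (ℕP.≤-reflexive last≡m₂))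
  where
  last≡m₂ : suc (ℕ.pred (m₂ Y)) ≡ m₂ Y
  last≡m₂ = ℕP.suc-pred (m₂ Y) {{ℕ.>-nonZero (pos Y Fin.zero)}}

_∋?_ : (Y : YD) (ab : ℕ × ℕ) → Dec (Y ∋ ab)
Y ∋? (zero , b) = no (λ { ((i , j) , ()) })
Y ∋? (suc a , zero) = no (λ { ((i , j) , ()) })
Y ∋? (suc a , suc b) with a ℕ.<? m₁ Y
... | no a≮m₁ = no (λ { ((i , j) , refl) → a≮m₁ (FinP.toℕ<n i) })
... | yes a<m₁ with b ℕ.<? row Y (fromℕ< a<m₁)
...   | yes b<row = yes (∋-fromℕ< Y a<m₁ b<row)
...   | no b≮row = no (λ { ((i , j) , refl) →
                      b≮row (subst (λ i′ → toℕ j < row Y i′) (sym (FinP.fromℕ<-toℕ i a<m₁)) (FinP.toℕ<n j)) })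

-- Case (b) is case (a) with rows and columns exchanged: `along` is the coordinate in which a box
-- steps to its neighbour on the next diagonal, `across` the other one.
data Orientation : Set where
  byRows byColumns : Orientation

orient : Orientation → ℕ × ℕ → ℕ × ℕ
orient byRows    uv      = uv
orient byColumns (u , v) = v , u

_∋⟨_⟩_ : YD → Orientation → ℕ × ℕ → Set
Y ∋⟨ o ⟩ uv = Y ∋ orient o uv

along across : Orientation → (Y : YD) → Box Y → ℕ
along  byRows    = rowOf
along  byColumns = colOf
across byRows    = colOf
across byColumns = rowOf

alongExtent acrossExtent : Orientation → YD → ℕ
alongExtent  byRows    = m₁
alongExtent  byColumns = m₂
acrossExtent byRows    = m₂
acrossExtent byColumns = m₁

∋⟨⟩-box : ∀ o Y (p : Box Y) → Y ∋⟨ o ⟩ (along o Y p , across o Y p)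
∋⟨⟩-box byRows    Y p = p , refl
∋⟨⟩-box byColumns Y p = p , refl

along-∋⟨⟩ : ∀ o Y {a b} (m : Y ∋⟨ o ⟩ (a , b)) → along o Y (proj₁ m) ≡ a
along-∋⟨⟩ byRows    Y m = cong proj₁ (proj₂ m)
along-∋⟨⟩ byColumns Y m = cong proj₂ (proj₂ m)

across-∋⟨⟩ : ∀ o Y {a b} (m : Y ∋⟨ o ⟩ (a , b)) → across o Y (proj₁ m) ≡ b
across-∋⟨⟩ byRows    Y m = cong proj₂ (proj₂ m)
across-∋⟨⟩ byColumns Y m = cong proj₁ (proj₂ m)

box-injective⟨⟩ : ∀ o Y {p q} → along o Y p ≡ along o Y q → across o Y p ≡ across o Y q → p ≡ q
box-injective⟨⟩ byRows    Y = box-injective Y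
box-injective⟨⟩ byColumns Y e e′ = box-injective Y e′ e

_∋⟨_⟩?_ : ∀ Y o ab → Dec (Y ∋⟨ o ⟩ ab)
Y ∋⟨ o ⟩? ab = Y ∋? orient o ab

∋⟨⟩-down : ∀ o Y {a b a′ b′} → Y ∋⟨ o ⟩ (a , b) → 1 ≤ a′ → 1 ≤ b′ → a′ ≤ a → b′ ≤ b → Y ∋⟨ o ⟩ (a′ , b′)
∋⟨⟩-down byRows    Y m 1≤a′ 1≤b′ a′≤a b′≤b = ∋-down Y m 1≤a′ 1≤b′ a′≤a b′≤b
∋⟨⟩-down byColumns Y m 1≤a′ 1≤b′ a′≤a b′≤b = ∋-down Y m 1≤b′ 1≤a′ b′≤b a′≤a

≤ᵇ⇒≤⟨⟩ : ∀ o Y {p q} → _≤ᵇ_ {Y} p q → along o Y p ≤ along o Y q × across o Y p ≤ across o Y q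
≤ᵇ⇒≤⟨⟩ byRows    Y (le , le′) = le , le′
≤ᵇ⇒≤⟨⟩ byColumns Y (le , le′) = le′ , le

≤⟨⟩⇒≤ᵇ : ∀ o Y {p q} → along o Y p ≤ along o Y q → across o Y p ≤ across o Y q → _≤ᵇ_ {Y} p q
≤⟨⟩⇒≤ᵇ byRows    Y le le′ = le , le′
≤⟨⟩⇒≤ᵇ byColumns Y le le′ = le′ , le

along≤alongExtent : ∀ o Y (p : Box Y) → along o Y p ≤ alongExtent o Y
along≤alongExtent byRows    = rowOf≤m₁
along≤alongExtent byColumns = colOf≤m₂

across≤acrossExtent : ∀ o Y (p : Box Y) → across o Y p ≤ acrossExtent o Y
across≤acrossExtent byRows    = colOf≤m₂
across≤acrossExtent byColumns = rowOf≤m₁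

∋⟨⟩-alongExtent : ∀ o Y → Y ∋⟨ o ⟩ (alongExtent o Y , 1)
∋⟨⟩-alongExtent byRows    = ∋-m₁,1
∋⟨⟩-alongExtent byColumns = ∋-1,m₂

∋⟨⟩-acrossExtent : ∀ o Y → Y ∋⟨ o ⟩ (1 , acrossExtent o Y)
∋⟨⟩-acrossExtent byRows    = ∋-1,m₂
∋⟨⟩-acrossExtent byColumns = ∋-m₁,1

nDiag≡⟨⟩ : ∀ o Y → nDiag Y ≡ alongExtent o Y + acrossExtent o Y ∸ 1
nDiag≡⟨⟩ byRows    Y = refl
nDiag≡⟨⟩ byColumns Y = cong (_∸ 1) (ℕP.+-comm (m₁ Y) (m₂ Y))

diag≡diag⇒ : ∀ o Y {p q} → diag {Y} p ≡ diag {Y} q → along o Y p + across o Y q ≡ along o Y q + across o Y p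
diag≡diag⇒ byRows    Y {p} {q} e = m-n≡o-p⇒m+p≡o+n (rowOf Y p) (colOf Y p) (rowOf Y q) (colOf Y q) e
diag≡diag⇒ byColumns Y {p} {q} e = trans (ℕP.+-comm (colOf Y p) (rowOf Y q))
  (trans (sym (m-n≡o-p⇒m+p≡o+n (rowOf Y p) (colOf Y p) (rowOf Y q) (colOf Y q) e)) (ℕP.+-comm (rowOf Y p) (colOf Y q)))

diag≡diag⇐ : ∀ o Y {p q} → along o Y p + across o Y q ≡ along o Y q + across o Y p → diag {Y} p ≡ diag {Y} q
diag≡diag⇐ byRows    Y {p} {q} e = m+p≡o+n⇒m-n≡o-p (rowOf Y p) (colOf Y p) (rowOf Y q) (colOf Y q) e
diag≡diag⇐ byColumns Y {p} {q} e = m+p≡o+n⇒m-n≡o-p (rowOf Y p) (colOf Y p) (rowOf Y q) (colOf Y q)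
  (trans (ℕP.+-comm (rowOf Y p) (colOf Y q)) (trans (sym e) (ℕP.+-comm (colOf Y p) (rowOf Y q))))

term≤sumMap : {X : Set} {f : X → ℕ} (xs : List X) {x : X} → x ∈ xs → f x ≤ ℕSum.sumMap f xs
term≤sumMap {f = f} (y ∷ ys) (here refl)  = ℕP.m≤m+n (f y) _
term≤sumMap {f = f} (y ∷ ys) (there x∈ys) = ℕP.≤-trans (term≤sumMap ys x∈ys) (ℕP.m≤n+m _ (f y))

count : (Y : YD) {P : Box Y → Set} → ((b : Box Y) → Dec (P b)) → ℕ
count Y P? = ℕSum.sumBoxes Y (λ b → if does (P? b) then 1 else 0)

count-cong : (Y : YD) {P Q : Box Y → Set} (P? : ∀ b → Dec (P b)) (Q? : ∀ b → Dec (Q b)) →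
             (∀ b → P b → Q b) → (∀ b → Q b → P b) → count Y P? ≡ count Y Q?
count-cong Y P? Q? P⇒Q Q⇒P = ℕSum.sumBoxes-cong Y agree
  where
  agree : ∀ b → (if does (P? b) then 1 else 0) ≡ (if does (Q? b) then 1 else 0)
  agree b with P? b | Q? b
  ... | yes _ | yes _ = refl
  ... | no  _ | no  _ = refl
  ... | yes p | no ¬q = ⊥-elim (¬q (P⇒Q b p))
  ... | no ¬p | yes q = ⊥-elim (¬p (Q⇒P b q))

count-matching : (Y : YD) {P Q H : Box Y → Set}
  (P? : ∀ b → Dec (P b)) (Q? : ∀ b → Dec (Q b)) (H? : ∀ b → Dec (H b)) (f g : Box Y → Box Y) →
  (∀ p → P p → H p → Q (f p) × g (f p) ≡ p) → (∀ q → Q q → (P (g q) × H (g q)) × f (g q) ≡ q) →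
  count Y P? ≡ count Y Q? → ∀ p → P p → H p
count-matching Y {P} {Q} {H} P? Q? H? f g f-on g-on equal p Pp with H? p
... | yes Hp = Hp
... | no ¬Hp = ⊥-elim (ℕP.<-irrefl (sym equal) (begin-strict
  count Y Q?                                                      ≡⟨ ℕP.+-identityʳ _ ⟨
  count Y Q? + 0                                                  <⟨ ℕP.+-monoʳ-< (count Y Q?) unmatched>0 ⟩
  count Y Q? + count Y (λ b → P? b ×-dec ¬? (H? b))              ≡⟨ cong (_+ _) matched≡Q ⟨
  count Y (λ b → P? b ×-dec H? b) + count Y (λ b → P? b ×-dec ¬? (H? b)) ≡⟨ split ⟨
  count Y P?                                                      ∎))
  where
  open ℕP.≤-Reasoning
  ind : {A : Set} → Dec A → ℕ
  ind d = if does d then 1 else 0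

  ind-split : ∀ {A B : Set} (a : Dec A) (b : Dec B) → ind a ≡ ind (a ×-dec b) + ind (a ×-dec ¬? b)
  ind-split (yes _) (yes _) = refl
  ind-split (yes _) (no  _) = refl
  ind-split (no  _) _       = refl

  split : count Y P? ≡ count Y (λ b → P? b ×-dec H? b) + count Y (λ b → P? b ×-dec ¬? (H? b))
  split = trans (ℕSum.sumBoxes-cong Y (λ b → ind-split (P? b) (H? b))) (ℕSum.sumMap-⊕ _ _ (boxes Y))

  matched≡Q : count Y (λ b → P? b ×-dec H? b) ≡ count Y Q?
  matched≡Q = ℕSum.sumBoxes-reindex Y Y f g _ _ forth back
    where
    forth : ∀ a → ind (P? a ×-dec H? a) ≡ 0 ⊎ (g (f a) ≡ a × ind (Q? (f a)) ≡ ind (P? a ×-dec H? a))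
    forth a with P? a | H? a
    ... | no  _  | _      = inj₁ refl
    ... | yes _  | no  _  = inj₁ refl
    ... | yes Pa | yes Ha with f-on a Pa Ha
    ...   | Qfa , gfa≡a = inj₂ (gfa≡a , if-does (Q? (f a)) (λ _ → refl) (λ ¬Q → ⊥-elim (¬Q Qfa)))
    back : ∀ b → ind (Q? b) ≡ 0 ⊎ (f (g b) ≡ b × ind (P? (g b) ×-dec H? (g b)) ≡ ind (Q? b))
    back b with Q? b
    ... | no  _  = inj₁ refl
    ... | yes Qb with g-on b Qb
    ...   | PHgb , fgb≡b = inj₂ (fgb≡b , if-does (P? (g b) ×-dec H? (g b)) (λ _ → refl) (λ ¬PH → ⊥-elim (¬PH PHgb)))

  unmatched>0 : 0 < count Y (λ b → P? b ×-dec ¬? (H? b))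
  unmatched>0 = ℕP.<-≤-trans (subst (0 <_) (sym (if-does (P? p ×-dec ¬? (H? p)) (λ _ → refl) (λ n → ⊥-elim (n (Pp , ¬Hp))))) (s≤s z≤n))
                              (term≤sumMap (boxes Y) (∈-boxes Y p))

1≤along : ∀ o Y (p : Box Y) → 1 ≤ along o Y p
1≤along byRows    Y (i , j) = s≤s z≤n
1≤along byColumns Y (i , j) = s≤s z≤n

1≤across : ∀ o Y (p : Box Y) → 1 ≤ across o Y p
1≤across byRows    Y (i , j) = s≤s z≤n
1≤across byColumns Y (i , j) = s≤s z≤n

diagIndex<nDiag : (Y : YD) (p : Box Y) → diagIndex Y p < nDiag Y
diagIndex<nDiag Y p = ℕP.+-cancelˡ-< (rowOf Y p) _ _ (begin-strict
  rowOf Y p + diagIndex Y p   ≡⟨ rowOf+diagIndex Y p ⟩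
  n₁ Y + colOf Y p            ≤⟨ ℕP.+-monoʳ-≤ (n₁ Y) (colOf≤m₂ Y p) ⟩
  n₁ Y + m₂ Y                 <⟨ ℕP.+-monoˡ-< (n₁ Y + m₂ Y) (1≤along byRows Y p) ⟩
  rowOf Y p + (n₁ Y + m₂ Y)   ∎)
  where open ℕP.≤-Reasoning

along≡⇒diag≡ : ∀ o Y {p r : Box Y} {k} → along o Y r ≡ k + across o Y r → along o Y p ≡ k + across o Y p →
               diag {Y} p ≡ diag {Y} r
along≡⇒diag≡ o Y {p} {r} {k} er ep = diag≡diag⇐ o Y (begin
  along o Y p + across o Y r          ≡⟨ cong (_+ across o Y r) ep ⟩
  k + across o Y p + across o Y r     ≡⟨ swap k (across o Y p) (across o Y r) ⟩
  k + across o Y r + across o Y p     ≡⟨ cong (_+ across o Y p) er ⟨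
  along o Y r + across o Y p          ∎)
  where
  open ≡-Reasoning
  swap : ∀ a b c → a + b + c ≡ a + c + b
  swap = ℕSolver.solve-∀

diag≡⇒along≡ : ∀ o Y {p r : Box Y} {k} → along o Y r ≡ k + across o Y r → diag {Y} p ≡ diag {Y} r →
               along o Y p ≡ k + across o Y p
diag≡⇒along≡ o Y {p} {r} {k} er e = ℕP.+-cancelʳ-≡ (across o Y r) _ _ (begin
  along o Y p + across o Y r          ≡⟨ diag≡diag⇒ o Y e ⟩
  along o Y r + across o Y p          ≡⟨ cong (_+ across o Y p) er ⟩
  k + across o Y r + across o Y p     ≡⟨ swap k (across o Y r) (across o Y p) ⟩
  k + across o Y p + across o Y r     ∎)
  where
  open ≡-Reasoning
  swap : ∀ a b c → a + b + c ≡ a + c + b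
  swap = ℕSolver.solve-∀

diagIndex-shift-byRows : ∀ {Y μ : YD} l (p₁ : Box Y) → rowOf Y p₁ ≡ suc l → colOf Y p₁ ≡ 1 →
  suc (m₁ μ) ≡ m₁ Y → (p : Box Y) (q : Box μ) → colOf Y p ≡ colOf μ q →
  (rowOf μ q < l + colOf μ q × rowOf Y p ≡ rowOf μ q) ⊎ (l + colOf μ q ≤ rowOf μ q × rowOf Y p ≡ suc (rowOf μ q)) →
  diagIndex Y p ≡ punchIn (diagIndex Y p₁) (diagIndex μ q)
diagIndex-shift-byRows {Y} {μ} l p₁ r₁≡ c₁≡ m₁≡ p q c≡ shift = shifted shift
  where
  open ℕP.≤-Reasoning
  i iμ iY : ℕ
  i = diagIndex Y p₁
  iμ = diagIndex μ q
  iY = diagIndex Y p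

  n₁≡ : n₁ Y ≡ suc (n₁ μ)
  n₁≡ = ℕP.suc-injective (sym m₁≡)

  i+l≡ : i + l ≡ suc (n₁ μ)
  i+l≡ = ℕP.suc-injective (begin-equality
    suc (i + l)          ≡⟨ cong suc (ℕP.+-comm i l) ⟩
    suc l + i            ≡⟨ cong (_+ i) r₁≡ ⟨
    rowOf Y p₁ + i       ≡⟨ rowOf+diagIndex Y p₁ ⟩
    n₁ Y + colOf Y p₁    ≡⟨ cong₂ _+_ n₁≡ c₁≡ ⟩
    suc (n₁ μ) + 1       ≡⟨ ℕP.+-comm (suc (n₁ μ)) 1 ⟩
    suc (suc (n₁ μ))     ∎)

  rowμ+iY : rowOf Y p + iY ≡ suc (rowOf μ q + iμ)
  rowμ+iY = begin-equality
    rowOf Y p + iY           ≡⟨ rowOf+diagIndex Y p ⟩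
    n₁ Y + colOf Y p         ≡⟨ cong₂ _+_ n₁≡ c≡ ⟩
    suc (n₁ μ + colOf μ q)   ≡⟨ cong suc (rowOf+diagIndex μ q) ⟨
    suc (rowOf μ q + iμ)     ∎

  shifted : (rowOf μ q < l + colOf μ q × rowOf Y p ≡ rowOf μ q) ⊎ (l + colOf μ q ≤ rowOf μ q × rowOf Y p ≡ suc (rowOf μ q)) →
            iY ≡ punchIn i iμ
  shifted (inj₁ (r<l+c , r≡)) = trans iY≡ (sym (punchIn-shifted i≤iμ))
    where
    iY≡ : iY ≡ suc iμ
    iY≡ = ℕP.+-cancelˡ-≡ (rowOf μ q) _ _
      (trans (cong (_+ iY) (sym r≡)) (trans rowμ+iY (sym (ℕP.+-suc (rowOf μ q) iμ))))
    i≤iμ : i ≤ iμ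
    i≤iμ = ℕP.+-cancelˡ-≤ (rowOf μ q) i iμ (ℕP.≤-pred (begin
      suc (rowOf μ q) + i              ≤⟨ ℕP.+-monoˡ-≤ i r<l+c ⟩
      l + colOf μ q + i                ≡⟨ cong (_+ i) (ℕP.+-comm l (colOf μ q)) ⟩
      colOf μ q + l + i                ≡⟨ ℕP.+-assoc (colOf μ q) l i ⟩
      colOf μ q + (l + i)              ≡⟨ cong (λ z → colOf μ q + z) (trans (ℕP.+-comm l i) i+l≡) ⟩
      colOf μ q + suc (n₁ μ)           ≡⟨ ℕP.+-comm (colOf μ q) (suc (n₁ μ)) ⟩
      suc (n₁ μ + colOf μ q)           ≡⟨ cong suc (rowOf+diagIndex μ q) ⟨
      suc (rowOf μ q + iμ)             ∎))
  shifted (inj₂ (l+c≤r , r≡)) = trans iY≡ (sym (punchIn-fixed iμ<i))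
    where
    iY≡ : iY ≡ iμ
    iY≡ = ℕP.+-cancelˡ-≡ (suc (rowOf μ q)) _ _ (trans (cong (_+ iY) (sym r≡)) rowμ+iY)
    iμ<i : iμ < i
    iμ<i = ℕP.+-cancelʳ-< (l + rowOf μ q) iμ i (begin-strict
      iμ + (l + rowOf μ q)             ≡⟨ rearrange iμ l (rowOf μ q) ⟩
      rowOf μ q + iμ + l               ≡⟨ cong (_+ l) (rowOf+diagIndex μ q) ⟩
      n₁ μ + colOf μ q + l             ≡⟨ rearrange′ (n₁ μ) (colOf μ q) l ⟩
      n₁ μ + (l + colOf μ q)           ≤⟨ ℕP.+-monoʳ-≤ (n₁ μ) l+c≤r ⟩
      n₁ μ + rowOf μ q                 <⟨ ℕP.n<1+n _ ⟩
      suc (n₁ μ) + rowOf μ q           ≡⟨ cong (_+ rowOf μ q) i+l≡ ⟨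
      i + l + rowOf μ q                ≡⟨ ℕP.+-assoc i l (rowOf μ q) ⟩
      i + (l + rowOf μ q)              ∎)
      where
      rearrange : ∀ a b c → a + (b + c) ≡ c + a + b
      rearrange = ℕSolver.solve-∀
      rearrange′ : ∀ a b c → a + b + c ≡ a + (c + b)
      rearrange′ = ℕSolver.solve-∀
diagIndex-shift-byColumns : ∀ {Y μ : YD} l (p₁ : Box Y) → colOf Y p₁ ≡ suc l → rowOf Y p₁ ≡ 1 →
  m₁ μ ≡ m₁ Y → (p : Box Y) (q : Box μ) → rowOf Y p ≡ rowOf μ q →
  (colOf μ q < l + rowOf μ q × colOf Y p ≡ colOf μ q) ⊎ (l + rowOf μ q ≤ colOf μ q × colOf Y p ≡ suc (colOf μ q)) →
  diagIndex Y p ≡ punchIn (diagIndex Y p₁) (diagIndex μ q)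
diagIndex-shift-byColumns {Y} {μ} l p₁ c₁≡ r₁≡ m₁≡ p q r≡ shift = shifted shift
  where
  open ℕP.≤-Reasoning
  i iμ iY : ℕ
  i = diagIndex Y p₁
  iμ = diagIndex μ q
  iY = diagIndex Y p

  n₁≡ : n₁ Y ≡ n₁ μ
  n₁≡ = ℕP.suc-injective (sym m₁≡)

  i≡ : i ≡ n₁ μ + l
  i≡ = ℕP.suc-injective (begin-equality
    suc i                  ≡⟨ cong (_+ i) r₁≡ ⟨
    rowOf Y p₁ + i         ≡⟨ rowOf+diagIndex Y p₁ ⟩
    n₁ Y + colOf Y p₁      ≡⟨ cong₂ _+_ n₁≡ c₁≡ ⟩
    n₁ μ + suc l           ≡⟨ ℕP.+-suc (n₁ μ) l ⟩
    suc (n₁ μ + l)         ∎)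

  rowμ+iY : rowOf μ q + iY ≡ n₁ μ + colOf Y p
  rowμ+iY = trans (cong (_+ iY) (sym r≡)) (trans (rowOf+diagIndex Y p) (cong (_+ colOf Y p) n₁≡))

  shifted : (colOf μ q < l + rowOf μ q × colOf Y p ≡ colOf μ q) ⊎ (l + rowOf μ q ≤ colOf μ q × colOf Y p ≡ suc (colOf μ q)) →
            iY ≡ punchIn i iμ
  shifted (inj₁ (c<l+r , c≡)) = trans iY≡ (sym (punchIn-fixed iμ<i))
    where
    iY≡ : iY ≡ iμ
    iY≡ = ℕP.+-cancelˡ-≡ (rowOf μ q) _ _
      (trans rowμ+iY (trans (cong (λ z → n₁ μ + z) c≡) (sym (rowOf+diagIndex μ q))))
    iμ<i : iμ < i
    iμ<i = ℕP.+-cancelˡ-< (rowOf μ q) iμ i (begin-strict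
      rowOf μ q + iμ           ≡⟨ rowOf+diagIndex μ q ⟩
      n₁ μ + colOf μ q         <⟨ ℕP.+-monoʳ-< (n₁ μ) c<l+r ⟩
      n₁ μ + (l + rowOf μ q)   ≡⟨ rearrange (n₁ μ) l (rowOf μ q) ⟩
      rowOf μ q + (n₁ μ + l)   ≡⟨ cong (λ z → rowOf μ q + z) i≡ ⟨
      rowOf μ q + i            ∎)
      where
      rearrange : ∀ a b c → a + (b + c) ≡ c + (a + b)
      rearrange = ℕSolver.solve-∀
  shifted (inj₂ (l+r≤c , c≡)) = trans iY≡ (sym (punchIn-shifted i≤iμ))
    where
    iY≡ : iY ≡ suc iμ
    iY≡ = ℕP.+-cancelˡ-≡ (rowOf μ q) _ _ (begin-equality
      rowOf μ q + iY           ≡⟨ rowμ+iY ⟩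
      n₁ μ + colOf Y p         ≡⟨ cong (λ z → n₁ μ + z) c≡ ⟩
      n₁ μ + suc (colOf μ q)   ≡⟨ ℕP.+-suc (n₁ μ) (colOf μ q) ⟩
      suc (n₁ μ + colOf μ q)   ≡⟨ cong suc (rowOf+diagIndex μ q) ⟨
      suc (rowOf μ q + iμ)     ≡⟨ ℕP.+-suc (rowOf μ q) iμ ⟨
      rowOf μ q + suc iμ       ∎)
    i≤iμ : i ≤ iμ
    i≤iμ = ℕP.+-cancelˡ-≤ (rowOf μ q) i iμ (begin
      rowOf μ q + i            ≡⟨ cong (λ z → rowOf μ q + z) i≡ ⟩
      rowOf μ q + (n₁ μ + l)   ≡⟨ rearrange (rowOf μ q) (n₁ μ) l ⟩
      n₁ μ + (l + rowOf μ q)   ≤⟨ ℕP.+-monoʳ-≤ (n₁ μ) l+r≤c ⟩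
      n₁ μ + colOf μ q         ≡⟨ rowOf+diagIndex μ q ⟨
      rowOf μ q + iμ           ∎)
      where
      rearrange : ∀ a b c → a + (b + c) ≡ b + (c + a)
      rearrange = ℕSolver.solve-∀

diagIndex-shift : ∀ o {Y μ : YD} l (p₁ : Box Y) → along o Y p₁ ≡ suc l → across o Y p₁ ≡ 1 →
  suc (alongExtent o μ) ≡ alongExtent o Y → acrossExtent o μ ≡ acrossExtent o Y →
  (p : Box Y) (q : Box μ) → across o Y p ≡ across o μ q →
  (along o μ q < l + across o μ q × along o Y p ≡ along o μ q) ⊎
  (l + across o μ q ≤ along o μ q × along o Y p ≡ suc (along o μ q)) →
  diagIndex Y p ≡ punchIn (diagIndex Y p₁) (diagIndex μ q)
diagIndex-shift byRows    {Y} {μ} l p₁ r₁≡ c₁≡ m₁≡ _   = diagIndex-shift-byRows {Y} {μ} l p₁ r₁≡ c₁≡ m₁≡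
diagIndex-shift byColumns {Y} {μ} l p₁ c₁≡ r₁≡ _   m₁≡ = diagIndex-shift-byColumns {Y} {μ} l p₁ c₁≡ r₁≡ m₁≡

RemovedBox : Orientation → YD → ℕ → ℕ × ℕ → Set
RemovedBox o Y l (a , b) = (Y ∋⟨ o ⟩ (a , b) × a < l + b) ⊎ (Y ∋⟨ o ⟩ (suc a , b) × l + b ≤ a)

module Removal (o : Orientation) (Y : YD) (l : ℕ) (l<alongExtent : suc l ≤ alongExtent o Y)
  (equal-count : count Y (λ p → along o Y p ℕ.≟ l + across o Y p) ≡ count Y (λ p → along o Y p ℕ.≟ suc l + across o Y p))
  where

  u v : Box Y → ℕ
  u = along o Y
  v = across o Y

  Onℓ Onℓ′ HasSuccessor : Box Y → Set
  Onℓ p = u p ≡ l + v p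
  Onℓ′ p = u p ≡ suc l + v p
  HasSuccessor p = Y ∋⟨ o ⟩ (suc (u p) , v p)

  up : Box Y → Box Y
  up p with u p ℕ.≟ l + v p | Y ∋⟨ o ⟩? (suc (u p) , v p)
  ... | yes _ | yes s = proj₁ s
  ... | _     | _     = p

  up-on : ∀ p → Onℓ p → HasSuccessor p → u (up p) ≡ suc (u p) × v (up p) ≡ v p
  up-on p on s with u p ℕ.≟ l + v p | Y ∋⟨ o ⟩? (suc (u p) , v p)
  ... | yes _   | yes s′ = along-∋⟨⟩ o Y s′ , across-∋⟨⟩ o Y s′
  ... | yes _   | no ¬s  = ⊥-elim (¬s s)
  ... | no ¬on  | _      = ⊥-elim (¬on on)

  up-off : ∀ p → ¬ Onℓ p → up p ≡ p
  up-off p ¬on with u p ℕ.≟ l + v p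
  ... | yes on = ⊥-elim (¬on on)
  ... | no  _  = refl

  predecessor : ∀ p → Onℓ′ p → Y ∋⟨ o ⟩ (l + v p , v p)
  predecessor p on′ = ∋⟨⟩-down o Y (∋⟨⟩-box o Y p) (ℕP.≤-trans (1≤across o Y p) (ℕP.m≤n+m (v p) l))
    (1≤across o Y p) (subst (l + v p ≤_) (sym on′) (ℕP.n≤1+n _)) ℕP.≤-refl

  down : Box Y → Box Y
  down p with u p ℕ.≟ suc l + v p
  ... | yes on′ = proj₁ (predecessor p on′)
  ... | no  _   = p

  down-on : ∀ p → Onℓ′ p → suc (u (down p)) ≡ u p × v (down p) ≡ v p
  down-on p on′ with u p ℕ.≟ suc l + v p
  ... | yes on″ = trans (cong suc (along-∋⟨⟩ o Y (predecessor p on″))) (sym on′) , across-∋⟨⟩ o Y (predecessor p on″)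
  ... | no ¬on′ = ⊥-elim (¬on′ on′)

  up-Onℓ′ : ∀ p → Onℓ p → HasSuccessor p → Onℓ′ (up p)
  up-Onℓ′ p on s with up-on p on s
  ... | u≡ , v≡ = trans u≡ (trans (cong suc on) (cong (λ z → suc l + z) (sym v≡)))

  down-Onℓ : ∀ p → Onℓ′ p → Onℓ (down p)
  down-Onℓ p on′ with down-on p on′
  ... | u≡ , v≡ = ℕP.suc-injective (trans u≡ (trans on′ (cong (λ z → suc l + z) (sym v≡))))

  down-HasSuccessor : ∀ p → Onℓ′ p → HasSuccessor (down p)
  down-HasSuccessor p on′ with down-on p on′
  ... | u≡ , v≡ = subst₂ (λ a b → Y ∋⟨ o ⟩ (a , b)) (sym u≡) (sym v≡) (∋⟨⟩-box o Y p)

  down∘up : ∀ p → Onℓ p → HasSuccessor p → down (up p) ≡ p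
  down∘up p on s with up-on p on s | down-on (up p) (up-Onℓ′ p on s)
  ... | u≡ , v≡ | u′≡ , v′≡ = box-injective⟨⟩ o Y (ℕP.suc-injective (trans u′≡ u≡)) (trans v′≡ v≡)

  up∘down : ∀ p → Onℓ′ p → up (down p) ≡ p
  up∘down p on′ with down-on p on′ | up-on (down p) (down-Onℓ p on′) (down-HasSuccessor p on′)
  ... | u≡ , v≡ | u′≡ , v′≡ = box-injective⟨⟩ o Y (trans u′≡ u≡) (trans v′≡ v≡)

  -- Otherwise diagonal ℓ would have more boxes than diagonal ℓ′, into which `up` injects those with a successor.
  successor : ∀ p → Onℓ p → HasSuccessor p
  successor = count-matching Y (λ p → u p ℕ.≟ l + v p) (λ p → u p ℕ.≟ suc l + v p)
    (λ p → Y ∋⟨ o ⟩? (suc (u p) , v p)) up down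
    (λ p on s → up-Onℓ′ p on s , down∘up p on s)
    (λ q on′ → (down-Onℓ q on′ , down-HasSuccessor q on′) , up∘down q on′)
    equal-count

  p₁∈Y : Y ∋⟨ o ⟩ (suc l , 1)
  p₁∈Y = ∋⟨⟩-down o Y (∋⟨⟩-alongExtent o Y) (s≤s z≤n) ℕP.≤-refl l<alongExtent ℕP.≤-refl

  p₁ p₂ : Box Y
  p₁ = proj₁ p₁∈Y
  p₂ = up p₁

  u₁≡ : u p₁ ≡ suc l
  u₁≡ = along-∋⟨⟩ o Y p₁∈Y

  v₁≡ : v p₁ ≡ 1
  v₁≡ = across-∋⟨⟩ o Y p₁∈Y

  Onℓ-p₁ : Onℓ p₁
  Onℓ-p₁ = trans u₁≡ (trans (ℕP.+-comm 1 l) (cong (λ z → l + z) (sym v₁≡)))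

  Onℓ′-p₂ : Onℓ′ p₂
  Onℓ′-p₂ = up-Onℓ′ p₁ Onℓ-p₁ (successor p₁ Onℓ-p₁)

  i i′ : ℕ
  i = diagIndex Y p₁
  i′ = diagIndex Y p₂

  diagAt-i : diagAt Y i ≡ diag {Y} p₁
  diagAt-i = sym (diagIndex≡⇒diag≡diagAt Y p₁ refl)

  diagAt-i′ : diagAt Y i′ ≡ diag {Y} p₂
  diagAt-i′ = sym (diagIndex≡⇒diag≡diagAt Y p₂ refl)

  Onℓ⇒diag : ∀ {p} → Onℓ p → diag {Y} p ≡ diagAt Y i
  Onℓ⇒diag on = trans (along≡⇒diag≡ o Y Onℓ-p₁ on) (sym diagAt-i)

  diag⇒Onℓ : ∀ {p} → diag {Y} p ≡ diagAt Y i → Onℓ p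
  diag⇒Onℓ e = diag≡⇒along≡ o Y Onℓ-p₁ (trans e diagAt-i)

  Onℓ′⇒diag : ∀ {p} → Onℓ′ p → diag {Y} p ≡ diagAt Y i′
  Onℓ′⇒diag on′ = trans (along≡⇒diag≡ o Y Onℓ′-p₂ on′) (sym diagAt-i′)

  diag⇒Onℓ′ : ∀ {p} → diag {Y} p ≡ diagAt Y i′ → Onℓ′ p
  diag⇒Onℓ′ e = diag≡⇒along≡ o Y Onℓ′-p₂ (trans e diagAt-i′)

  p≤up : ∀ p → Onℓ p → _≤ᵇ_ {Y} p (up p)
  p≤up p on with up-on p on (successor p on)
  ... | u≡ , v≡ = ≤⟨⟩⇒≤ᵇ o Y (subst (u p ≤_) (sym u≡) (ℕP.n≤1+n _)) (ℕP.≤-reflexive (sym v≡))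

  matching : DiagonalMatching Y i i′
  matching = record
    { up        = up
    ; down      = down
    ; up-off    = λ p ¬diag → up-off p (¬diag ∘ Onℓ⇒diag)
    ; ≤-up      = λ p e → p≤up p (diag⇒Onℓ e)
    ; diag-up   = λ p e → Onℓ′⇒diag (up-Onℓ′ p (diag⇒Onℓ e) (successor p (diag⇒Onℓ e)))
    ; diag-down = λ p e → Onℓ⇒diag (down-Onℓ p (diag⇒Onℓ′ e))
    ; up∘down   = λ p e → up∘down p (diag⇒Onℓ′ e)
    ; down∘up   = λ p e → down∘up p (diag⇒Onℓ e) (successor p (diag⇒Onℓ e))
    ; i′≢i      = λ i′≡i → ℕP.<⇒≢ (ℕP.n<1+n (l + v p₂))
                    (trans (sym (diag⇒Onℓ (trans (sym diagAt-i′) (cong (diagAt Y) i′≡i)))) Onℓ′-p₂)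
    ; i<nDiag   = diagIndex<nDiag Y p₁
    ; i′<nDiag  = diagIndex<nDiag Y p₂
    }

  module Contracted (μ : YD) (μ-boxes : ∀ ab → (μ ∋⟨ o ⟩ ab) ⇔ RemovedBox o Y l ab) where

    open Equivalence using (to; from)

    uμ vμ : Box μ → ℕ
    uμ = along o μ
    vμ = across o μ

    EmbedShift : Box μ → Box Y → Set
    EmbedShift q p = (uμ q < l + vμ q × u p ≡ uμ q) ⊎ (l + vμ q ≤ uμ q × u p ≡ suc (uμ q))

    embedFrom : ∀ q → RemovedBox o Y l (uμ q , vμ q) → Box Y
    embedFrom q (inj₁ (m , _)) = proj₁ m
    embedFrom q (inj₂ (m , _)) = proj₁ m

    embedFrom-shift : ∀ q r → v (embedFrom q r) ≡ vμ q × EmbedShift q (embedFrom q r)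
    embedFrom-shift q (inj₁ (m , lt)) = across-∋⟨⟩ o Y m , inj₁ (lt , along-∋⟨⟩ o Y m)
    embedFrom-shift q (inj₂ (m , ge)) = across-∋⟨⟩ o Y m , inj₂ (ge , along-∋⟨⟩ o Y m)

    embed : Box μ → Box Y
    embed q = embedFrom q (to (μ-boxes _) (∋⟨⟩-box o μ q))

    embed-shift : ∀ q → v (embed q) ≡ vμ q × EmbedShift q (embed q)
    embed-shift q = embedFrom-shift q (to (μ-boxes _) (∋⟨⟩-box o μ q))

    embed-v : ∀ q → v (embed q) ≡ vμ q
    embed-v q = proj₁ (embed-shift q)

    embed-lo : ∀ q → uμ q < l + vμ q → u (embed q) ≡ uμ q
    embed-lo q lt with proj₂ (embed-shift q)
    ... | inj₁ (_ , e)  = e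
    ... | inj₂ (ge , _) = ⊥-elim (ℕP.<⇒≱ lt ge)

    embed-hi : ∀ q → l + vμ q ≤ uμ q → u (embed q) ≡ suc (uμ q)
    embed-hi q ge with proj₂ (embed-shift q)
    ... | inj₁ (lt , _) = ⊥-elim (ℕP.<⇒≱ lt ge)
    ... | inj₂ (_ , e)  = e

    collapseFrom : ∀ p → Tri (u p < l + v p) (u p ≡ l + v p) (l + v p < u p) → Box μ
    collapseFrom p (tri< lt _ _) = proj₁ (from (μ-boxes _) (inj₁ (∋⟨⟩-box o Y p , lt)))
    collapseFrom p (tri≈ _ on _) = proj₁ (from (μ-boxes _) (inj₂ (successor p on , ℕP.≤-reflexive (sym on))))
    collapseFrom p (tri> _ _ gt) = proj₁ (from (μ-boxes (ℕ.pred (u p) , v p))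
      (inj₂ (subst (λ a → Y ∋⟨ o ⟩ (a , v p)) (sym (suc-pred-u gt)) (∋⟨⟩-box o Y p) , ℕP.pred-mono-≤ gt)))
      where
      suc-pred-u : l + v p < u p → suc (ℕ.pred (u p)) ≡ u p
      suc-pred-u gt = ℕP.suc-pred (u p) {{ℕ.>-nonZero (ℕP.<-≤-trans (s≤s z≤n) gt)}}

    CollapseShift : Box Y → Box μ → Set
    CollapseShift p q = (u p ≤ l + v p × uμ q ≡ u p) ⊎ (l + v p < u p × suc (uμ q) ≡ u p)

    collapseFrom-shift : ∀ p t → vμ (collapseFrom p t) ≡ v p × CollapseShift p (collapseFrom p t)
    collapseFrom-shift p (tri< lt _ _) = across-∋⟨⟩ o μ m , inj₁ (ℕP.<⇒≤ lt , along-∋⟨⟩ o μ m)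
      where
      m : μ ∋⟨ o ⟩ (u p , v p)
      m = from (μ-boxes _) (inj₁ (∋⟨⟩-box o Y p , lt))
    collapseFrom-shift p (tri≈ _ on _) = across-∋⟨⟩ o μ m , inj₁ (ℕP.≤-reflexive on , along-∋⟨⟩ o μ m)
      where
      m : μ ∋⟨ o ⟩ (u p , v p)
      m = from (μ-boxes _) (inj₂ (successor p on , ℕP.≤-reflexive (sym on)))
    collapseFrom-shift p (tri> _ _ gt) = across-∋⟨⟩ o μ m , inj₂ (gt , trans (cong suc (along-∋⟨⟩ o μ m)) suc-pred-u)
      where
      suc-pred-u : suc (ℕ.pred (u p)) ≡ u p
      suc-pred-u = ℕP.suc-pred (u p) {{ℕ.>-nonZero (ℕP.<-≤-trans (s≤s z≤n) gt)}}
      m : μ ∋⟨ o ⟩ (ℕ.pred (u p) , v p)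
      m = from (μ-boxes (ℕ.pred (u p) , v p))
        (inj₂ (subst (λ a → Y ∋⟨ o ⟩ (a , v p)) (sym suc-pred-u) (∋⟨⟩-box o Y p) , ℕP.pred-mono-≤ gt))

    collapse : Box Y → Box μ
    collapse p = collapseFrom p (ℕP.<-cmp (u p) (l + v p))

    collapse-shift : ∀ p → vμ (collapse p) ≡ v p × CollapseShift p (collapse p)
    collapse-shift p = collapseFrom-shift p (ℕP.<-cmp (u p) (l + v p))

    collapse-v : ∀ p → vμ (collapse p) ≡ v p
    collapse-v p = proj₁ (collapse-shift p)

    collapse-lo : ∀ p → u p ≤ l + v p → uμ (collapse p) ≡ u p
    collapse-lo p le with proj₂ (collapse-shift p)
    ... | inj₁ (_ , e)  = e
    ... | inj₂ (gt , _) = ⊥-elim (ℕP.<⇒≱ gt le)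

    collapse-hi : ∀ p → l + v p < u p → suc (uμ (collapse p)) ≡ u p
    collapse-hi p gt with proj₂ (collapse-shift p)
    ... | inj₁ (le , _) = ⊥-elim (ℕP.<⇒≱ gt le)
    ... | inj₂ (_ , e)  = e

    collapse∘embed : ∀ q → collapse (embed q) ≡ q
    collapse∘embed q with uμ q ℕ.<? l + vμ q
    ... | yes lt = box-injective⟨⟩ o μ
      (trans (collapse-lo (embed q) (subst₂ (λ a b → a ≤ l + b) (sym (embed-lo q lt)) (sym (embed-v q)) (ℕP.<⇒≤ lt)))
             (embed-lo q lt))
      (trans (collapse-v (embed q)) (embed-v q))
    ... | no ¬lt = box-injective⟨⟩ o μ
      (ℕP.suc-injective (trans (collapse-hi (embed q) (subst₂ (λ a b → l + b < a) (sym (embed-hi q ge)) (sym (embed-v q)) (s≤s ge)))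
                               (embed-hi q ge)))
      (trans (collapse-v (embed q)) (embed-v q))
      where
      ge = ℕP.≮⇒≥ ¬lt

    embed∘collapse : ∀ p → embed (collapse p) ≡ up p
    embed∘collapse p = [ onL , (λ ¬on → trans (offL ¬on) (sym (up-off p ¬on))) ]′ (toSum (u p ℕ.≟ l + v p))
      where
      same-v : v (embed (collapse p)) ≡ v p
      same-v = trans (embed-v (collapse p)) (collapse-v p)

      onL : Onℓ p → embed (collapse p) ≡ up p
      onL on = box-injective⟨⟩ o Y
        (trans (embed-hi (collapse p) (subst₂ (λ a b → l + b ≤ a) (sym (collapse-lo p (ℕP.≤-reflexive on))) (sym (collapse-v p))
                                              (ℕP.≤-reflexive (sym on))))
               (trans (cong suc (collapse-lo p (ℕP.≤-reflexive on))) (sym (proj₁ (up-on p on (successor p on))))))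
        (trans same-v (sym (proj₂ (up-on p on (successor p on)))))

      offL : ¬ Onℓ p → embed (collapse p) ≡ p
      offL ¬on = [ below , (λ ¬lt → above (ℕP.≤∧≢⇒< (ℕP.≮⇒≥ ¬lt) (≢-sym ¬on))) ]′ (toSum (u p ℕ.<? l + v p))
        where
        below : u p < l + v p → embed (collapse p) ≡ p
        below lt = box-injective⟨⟩ o Y
          (trans (embed-lo (collapse p) (subst₂ (λ a b → a < l + b) (sym (collapse-lo p (ℕP.<⇒≤ lt))) (sym (collapse-v p)) lt))
                 (collapse-lo p (ℕP.<⇒≤ lt)))
          same-v
        above : l + v p < u p → embed (collapse p) ≡ p
        above gt = box-injective⟨⟩ o Y
          (trans (embed-hi (collapse p) (ℕP.≤-pred (subst₂ (λ a b → l + b < a) (sym (collapse-hi p gt)) (sym (collapse-v p)) gt)))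
                 (collapse-hi p gt))
          same-v

    collapse-mono : ∀ {p p′} → _≤ᵇ_ {Y} p p′ → _≤ᵇ_ {μ} (collapse p) (collapse p′)
    collapse-mono {p} {p′} p≤p′ = ≤⟨⟩⇒≤ᵇ o μ uμ-mono (subst₂ _≤_ (sym (collapse-v p)) (sym (collapse-v p′)) v≤)
      where
      u≤ : u p ≤ u p′
      u≤ = proj₁ (≤ᵇ⇒≤⟨⟩ o Y p≤p′)
      v≤ : v p ≤ v p′
      v≤ = proj₂ (≤ᵇ⇒≤⟨⟩ o Y p≤p′)
      uμ-mono : uμ (collapse p) ≤ uμ (collapse p′)
      uμ-mono with u p ℕ.≤? l + v p | u p′ ℕ.≤? l + v p′
      ... | yes le | yes le′ = subst₂ _≤_ (sym (collapse-lo p le)) (sym (collapse-lo p′ le′)) u≤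
      ... | yes le | no ¬le′ = ℕP.≤-pred (subst₂ _<_ (sym (collapse-lo p le)) (sym (collapse-hi p′ (ℕP.≰⇒> ¬le′)))
                                 (ℕP.≤-<-trans le (ℕP.≤-<-trans (ℕP.+-monoʳ-≤ l v≤) (ℕP.≰⇒> ¬le′))))
      ... | no ¬le | yes le′ = ℕP.<⇒≤ (subst₂ _≤_ (sym (collapse-hi p (ℕP.≰⇒> ¬le))) (sym (collapse-lo p′ le′)) u≤)
      ... | no ¬le | no ¬le′ = ℕP.≤-pred (subst₂ _≤_ (sym (collapse-hi p (ℕP.≰⇒> ¬le))) (sym (collapse-hi p′ (ℕP.≰⇒> ¬le′))) u≤)

    embed-mono : ∀ {q q′} → _≤ᵇ_ {μ} q q′ → _≤ᵇ_ {Y} (embed q) (embed q′) ⊎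
                   ∃ λ r → diag {Y} r ≡ diagAt Y i × _≤ᵇ_ {Y} (embed q) (up r) × _≤ᵇ_ {Y} r (embed q′)
    embed-mono {q} {q′} q≤q′ with uμ q ℕ.<? l + vμ q | uμ q′ ℕ.<? l + vμ q′
    ... | yes lt | yes lt′ = inj₁ (≤⟨⟩⇒≤ᵇ o Y (subst₂ _≤_ (sym (embed-lo q lt)) (sym (embed-lo q′ lt′)) u≤) v-mono)
      where
      u≤ : uμ q ≤ uμ q′
      u≤ = proj₁ (≤ᵇ⇒≤⟨⟩ o μ q≤q′)
      v-mono : v (embed q) ≤ v (embed q′)
      v-mono = subst₂ _≤_ (sym (embed-v q)) (sym (embed-v q′)) (proj₂ (≤ᵇ⇒≤⟨⟩ o μ q≤q′))
    ... | yes lt | no ¬lt′ = inj₁ (≤⟨⟩⇒≤ᵇ o Y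
            (subst₂ _≤_ (sym (embed-lo q lt)) (sym (embed-hi q′ (ℕP.≮⇒≥ ¬lt′))) (ℕP.m≤n⇒m≤1+n (proj₁ (≤ᵇ⇒≤⟨⟩ o μ q≤q′))))
            (subst₂ _≤_ (sym (embed-v q)) (sym (embed-v q′)) (proj₂ (≤ᵇ⇒≤⟨⟩ o μ q≤q′))))
    ... | no ¬lt | no ¬lt′ = inj₁ (≤⟨⟩⇒≤ᵇ o Y
            (subst₂ _≤_ (sym (embed-hi q (ℕP.≮⇒≥ ¬lt))) (sym (embed-hi q′ (ℕP.≮⇒≥ ¬lt′))) (s≤s (proj₁ (≤ᵇ⇒≤⟨⟩ o μ q≤q′))))
            (subst₂ _≤_ (sym (embed-v q)) (sym (embed-v q′)) (proj₂ (≤ᵇ⇒≤⟨⟩ o μ q≤q′))))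
    ... | no ¬lt | yes lt′ = inj₂ (r , Onℓ⇒diag on , ≤⟨⟩⇒≤ᵇ o Y eq≤upr-u eq≤upr-v , ≤⟨⟩⇒≤ᵇ o Y r≤eq′-u r≤eq′-v)
      where
      -- q lies strictly beyond the removed diagonal and q′ strictly before it: they are
      -- compared through the box r of that diagonal in the row (column) of q.
      u≤ : uμ q ≤ uμ q′
      u≤ = proj₁ (≤ᵇ⇒≤⟨⟩ o μ q≤q′)
      v≤ : vμ q ≤ vμ q′
      v≤ = proj₂ (≤ᵇ⇒≤⟨⟩ o μ q≤q′)
      ge : l + vμ q ≤ uμ q
      ge = ℕP.≮⇒≥ ¬lt
      c : ℕ
      c = uμ q ∸ l
      l+c≡ : l + c ≡ uμ q
      l+c≡ = ℕP.m+[n∸m]≡n (ℕP.≤-trans (ℕP.m≤m+n l (vμ q)) ge)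
      v≤c : vμ q ≤ c
      v≤c = ℕP.+-cancelˡ-≤ l (vμ q) c (subst (l + vμ q ≤_) (sym l+c≡) ge)
      c<v′ : c < vμ q′
      c<v′ = ℕP.+-cancelˡ-< l c (vμ q′) (subst (_< l + vμ q′) (sym l+c≡) (ℕP.≤-<-trans u≤ lt′))
      q′∈Y : Y ∋⟨ o ⟩ (uμ q′ , vμ q′)
      q′∈Y = subst₂ (λ a b → Y ∋⟨ o ⟩ (a , b)) (embed-lo q′ lt′) (embed-v q′) (∋⟨⟩-box o Y (embed q′))
      r∈Y : Y ∋⟨ o ⟩ (uμ q , c)
      r∈Y = ∋⟨⟩-down o Y q′∈Y (1≤along o μ q) (ℕP.≤-trans (1≤across o μ q) v≤c) u≤ (ℕP.<⇒≤ c<v′)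
      r : Box Y
      r = proj₁ r∈Y
      on : Onℓ r
      on = trans (along-∋⟨⟩ o Y r∈Y) (trans (sym l+c≡) (cong (λ z → l + z) (sym (across-∋⟨⟩ o Y r∈Y))))
      up-r : u (up r) ≡ suc (u r) × v (up r) ≡ v r
      up-r = up-on r on (successor r on)
      eq≤upr-u : u (embed q) ≤ u (up r)
      eq≤upr-u = ℕP.≤-reflexive (trans (embed-hi q ge) (trans (cong suc (sym (along-∋⟨⟩ o Y r∈Y))) (sym (proj₁ up-r))))
      eq≤upr-v : v (embed q) ≤ v (up r)
      eq≤upr-v = subst₂ _≤_ (sym (embed-v q)) (sym (trans (proj₂ up-r) (across-∋⟨⟩ o Y r∈Y))) v≤c
      r≤eq′-u : u r ≤ u (embed q′)
      r≤eq′-u = subst₂ _≤_ (sym (along-∋⟨⟩ o Y r∈Y)) (sym (embed-lo q′ lt′)) u≤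
      r≤eq′-v : v r ≤ v (embed q′)
      r≤eq′-v = subst₂ _≤_ (sym (across-∋⟨⟩ o Y r∈Y)) (sym (embed-v q′)) (ℕP.<⇒≤ c<v′)

    private
      up-p₁ : u p₂ ≡ suc (u p₁) × v p₂ ≡ v p₁
      up-p₁ = up-on p₁ Onℓ-p₁ (successor p₁ Onℓ-p₁)

      u₂≡ : u p₂ ≡ suc (suc l)
      u₂≡ = trans (proj₁ up-p₁) (cong suc u₁≡)

      v₂≡ : v p₂ ≡ 1
      v₂≡ = trans (proj₂ up-p₁) v₁≡

      l+1<u₂ : l + v p₂ < u p₂
      l+1<u₂ = subst₂ (λ a b → l + b < a) (sym u₂≡) (sym v₂≡) (s≤s (ℕP.≤-reflexive (ℕP.+-comm l 1)))

      l+1≤alongExtentμ : l + 1 ≤ alongExtent o μ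
      l+1≤alongExtentμ = subst (_≤ alongExtent o μ)
        (trans (ℕP.suc-injective (trans (collapse-hi p₂ l+1<u₂) u₂≡)) (ℕP.+-comm 1 l))
        (along≤alongExtent o μ (collapse p₂))

    alongExtent-suc : suc (alongExtent o μ) ≡ alongExtent o Y
    alongExtent-suc = ℕP.≤-antisym
      (subst (_≤ alongExtent o Y) (trans (embed-hi cμ cμ-beyond) (cong suc (along-∋⟨⟩ o μ cμ∈))) (along≤alongExtent o Y (embed cμ)))
      (subst (_≤ suc (alongExtent o μ)) (trans (collapse-hi cY cY-beyond) (along-∋⟨⟩ o Y cY∈)) (s≤s (along≤alongExtent o μ (collapse cY))))
      where
      cμ∈ : μ ∋⟨ o ⟩ (alongExtent o μ , 1)
      cμ∈ = ∋⟨⟩-alongExtent o μ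
      cμ : Box μ
      cμ = proj₁ cμ∈
      cμ-beyond : l + vμ cμ ≤ uμ cμ
      cμ-beyond = subst₂ (λ a b → l + b ≤ a) (sym (along-∋⟨⟩ o μ cμ∈)) (sym (across-∋⟨⟩ o μ cμ∈)) l+1≤alongExtentμ
      cY∈ : Y ∋⟨ o ⟩ (alongExtent o Y , 1)
      cY∈ = ∋⟨⟩-alongExtent o Y
      cY : Box Y
      cY = proj₁ cY∈
      cY-beyond : l + v cY < u cY
      cY-beyond = subst₂ (λ a b → l + b < a) (sym (along-∋⟨⟩ o Y cY∈)) (sym (across-∋⟨⟩ o Y cY∈))
        (ℕP.<-≤-trans (subst₂ (λ a b → l + b < a) u₂≡ v₂≡ l+1<u₂) (subst (_≤ alongExtent o Y) u₂≡ (along≤alongExtent o Y p₂)))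

    acrossExtent-≡ : acrossExtent o μ ≡ acrossExtent o Y
    acrossExtent-≡ = ℕP.≤-antisym
      (subst (_≤ acrossExtent o Y) (trans (embed-v cμ) (across-∋⟨⟩ o μ cμ∈)) (across≤acrossExtent o Y (embed cμ)))
      (subst (_≤ acrossExtent o μ) (trans (collapse-v cY) (across-∋⟨⟩ o Y cY∈)) (across≤acrossExtent o μ (collapse cY)))
      where
      cμ∈ : μ ∋⟨ o ⟩ (1 , acrossExtent o μ)
      cμ∈ = ∋⟨⟩-acrossExtent o μ
      cμ : Box μ
      cμ = proj₁ cμ∈
      cY∈ : Y ∋⟨ o ⟩ (1 , acrossExtent o Y)
      cY∈ = ∋⟨⟩-acrossExtent o Y
      cY : Box Y
      cY = proj₁ cY∈

    nDiag-suc : suc (nDiag μ) ≡ nDiag Y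
    nDiag-suc = begin
      suc (nDiag μ)                                      ≡⟨ cong suc (nDiag≡⟨⟩ o μ) ⟩
      suc (alongExtent o μ + acrossExtent o μ ∸ 1)       ≡⟨ ℕP.+-∸-assoc 1 1≤extents ⟨
      suc (alongExtent o μ) + acrossExtent o μ ∸ 1       ≡⟨ cong₂ (λ a c → a + c ∸ 1) alongExtent-suc acrossExtent-≡ ⟩
      alongExtent o Y + acrossExtent o Y ∸ 1             ≡⟨ nDiag≡⟨⟩ o Y ⟨
      nDiag Y                                            ∎
      where
      open ≡-Reasoning
      c : Box μ
      c = proj₁ (∋⟨⟩-acrossExtent o μ)
      1≤extents : 1 ≤ alongExtent o μ + acrossExtent o μ
      1≤extents = ℕP.≤-trans (ℕP.≤-trans (1≤across o μ c) (across≤acrossExtent o μ c)) (ℕP.m≤n+m _ (alongExtent o μ))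

    contraction : Contraction Y μ matching
    contraction = record
      { embed           = embed
      ; collapse        = collapse
      ; collapse∘embed  = collapse∘embed
      ; embed∘collapse  = embed∘collapse
      ; collapse-mono   = collapse-mono
      ; embed-mono      = embed-mono
      ; diagIndex-embed = λ q → diagIndex-shift o l p₁ u₁≡ v₁≡ alongExtent-suc acrossExtent-≡
                                  (embed q) q (embed-v q) (proj₂ (embed-shift q))
      ; nDiag-suc       = nDiag-suc
      }

diagonalOf : Orientation → ℕ → ℤ
diagonalOf byRows    l = + l
diagonalOf byColumns l = ℤ.- + l

diag≡diagonalOf⇒ : ∀ o Y {p : Box Y} l → diag {Y} p ≡ diagonalOf o l → along o Y p ≡ l + across o Y p
diag≡diagonalOf⇒ byRows Y {p} l e = trans (sym (ℕP.+-identityʳ (rowOf Y p)))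
  (m-n≡o-p⇒m+p≡o+n (rowOf Y p) (colOf Y p) l 0 (trans e (sym (ℤP.+-identityʳ (+ l)))))
diag≡diagonalOf⇒ byColumns Y {p} l e = trans (sym (m-n≡o-p⇒m+p≡o+n (rowOf Y p) (colOf Y p) 0 l
  (trans e (sym (ℤP.+-identityˡ (ℤ.- + l)))))) (ℕP.+-comm (rowOf Y p) l)

diag≡diagonalOf⇐ : ∀ o Y {p : Box Y} l → along o Y p ≡ l + across o Y p → diag {Y} p ≡ diagonalOf o l
diag≡diagonalOf⇐ byRows Y {p} l e = trans
  (m+p≡o+n⇒m-n≡o-p (rowOf Y p) (colOf Y p) l 0 (trans (ℕP.+-identityʳ (rowOf Y p)) e)) (ℤP.+-identityʳ (+ l))
diag≡diagonalOf⇐ byColumns Y {p} l e = trans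
  (m+p≡o+n⇒m-n≡o-p (rowOf Y p) (colOf Y p) 0 l (trans (ℕP.+-comm (rowOf Y p) l) (sym e))) (ℤP.+-identityˡ (ℤ.- + l))

diagPos-diag : (Y : YD) (p : Box Y) → diagPos Y (diag {Y} p) ≡ diagIndex Y p
diagPos-diag Y p = trans (cong ℤ.∣_∣ (trans (lemma (+ n₁ Y) (+ rowOf Y p) (+ colOf Y p)) (cong (ℤ._- + rowOf Y p) (sym (ℤP.pos-+ (n₁ Y) (colOf Y p))))))
  (∣m-n∣≡m∸n (subst (rowOf Y p ≤_) (rowOf+diagIndex Y p) (ℕP.m≤m+n (rowOf Y p) (diagIndex Y p))))
  where
  lemma : ∀ a b c → a ℤ.- (b ℤ.- c) ≡ (a ℤ.+ c) ℤ.- b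
  lemma = solve-∀

Removed : Orientation → YD → ℕ → ℕ × ℕ → Set
Removed byRows    Y l = RemovedA Y (+ l)
Removed byColumns Y l = RemovedB Y (ℤ.- + l)

Removed⇔RemovedBox : ∀ o Y l ab → Removed o Y l (orient o ab) ⇔ RemovedBox o Y l ab
Removed⇔RemovedBox byRows Y l (a , b) = mk⇔
  (Data.Sum.map (λ (m , lt) → m , a-b<l⇒ lt) (λ (m , lt) → m , l<1+a-b⇒ lt))
  (Data.Sum.map (λ (m , lt) → m , ⇒a-b<l lt) (λ (m , le) → m , ⇒l<1+a-b le))
  where
  a-b<l⇒ : + a ℤ.- + b ℤ.< + l → a < l + b
  a-b<l⇒ lt = subst (_< l + b) (ℕP.+-identityʳ a) (m-n<o-p⇒m+p<o+n a b l 0 (subst (+ a ℤ.- + b ℤ.<_) (sym (ℤP.+-identityʳ (+ l))) lt))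
  ⇒a-b<l : a < l + b → + a ℤ.- + b ℤ.< + l
  ⇒a-b<l lt = subst (+ a ℤ.- + b ℤ.<_) (ℤP.+-identityʳ (+ l)) (m+p<o+n⇒m-n<o-p a b l 0 (subst (_< l + b) (sym (ℕP.+-identityʳ a)) lt))
  l<1+a-b⇒ : + l ℤ.< + suc a ℤ.- + b → l + b ≤ a
  l<1+a-b⇒ lt = ℕP.≤-pred (subst (l + b <_) (ℕP.+-identityʳ (suc a))
    (m-n<o-p⇒m+p<o+n l 0 (suc a) b (subst (ℤ._< + suc a ℤ.- + b) (sym (ℤP.+-identityʳ (+ l))) lt)))
  ⇒l<1+a-b : l + b ≤ a → + l ℤ.< + suc a ℤ.- + b
  ⇒l<1+a-b le = subst (ℤ._< + suc a ℤ.- + b) (ℤP.+-identityʳ (+ l))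
    (m+p<o+n⇒m-n<o-p l 0 (suc a) b (subst (l + b <_) (sym (ℕP.+-identityʳ (suc a))) (s≤s le)))
Removed⇔RemovedBox byColumns Y l (a , b) = mk⇔
  (Data.Sum.map (λ (m , lt) → m , -l<b-a⇒ lt) (λ (m , lt) → m , b-1-a<-l⇒ lt))
  (Data.Sum.map (λ (m , lt) → m , ⇒-l<b-a lt) (λ (m , le) → m , ⇒b-1-a<-l le))
  where
  -l≡ : ℤ.- + l ≡ + 0 ℤ.- + l
  -l≡ = sym (ℤP.+-identityˡ (ℤ.- + l))
  -l<b-a⇒ : ℤ.- + l ℤ.< + b ℤ.- + a → a < l + b
  -l<b-a⇒ lt = subst (a <_) (ℕP.+-comm b l) (m-n<o-p⇒m+p<o+n 0 l b a (subst (ℤ._< + b ℤ.- + a) -l≡ lt))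
  ⇒-l<b-a : a < l + b → ℤ.- + l ℤ.< + b ℤ.- + a
  ⇒-l<b-a lt = subst (ℤ._< + b ℤ.- + a) (sym -l≡) (m+p<o+n⇒m-n<o-p 0 l b a (subst (a <_) (ℕP.+-comm l b) lt))
  b-1-a<-l⇒ : + b ℤ.- + suc a ℤ.< ℤ.- + l → l + b ≤ a
  b-1-a<-l⇒ lt = ℕP.≤-pred (subst (_< suc a) (ℕP.+-comm b l) (m-n<o-p⇒m+p<o+n b (suc a) 0 l (subst (+ b ℤ.- + suc a ℤ.<_) -l≡ lt)))
  ⇒b-1-a<-l : l + b ≤ a → + b ℤ.- + suc a ℤ.< ℤ.- + l
  ⇒b-1-a<-l le = subst (+ b ℤ.- + suc a ℤ.<_) (sym -l≡) (m+p<o+n⇒m-n<o-p b (suc a) 0 l (s≤s (subst (_≤ a) (ℕP.+-comm l b) le)))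

RemovalStatement : YD → List ℕ → ℕ → (ℕ × ℕ → Set) → ℤ → ℤ → Set
RemovalStatement Y d k Removed-ℓ ℓ ℓ′ =
  diagCount Y ℓ ≡ diagCount Y ℓ′ →
  (dAt Y d ℓ ≡ dAt Y d ℓ′ → (μ : YD) → HasBoxes μ Removed-ℓ →
     IntegrallyEquivalent Y μ (RestrictedOP Y k d) (RestrictedOP μ k (del d (diagPos Y ℓ))))
  × (dAt Y d ℓ′ < dAt Y d ℓ → Empty (RestrictedOP Y k d))

removal : ∀ o (Y : YD) (d : List ℕ) (k : ℕ) → 1 ≤ k → ∀ l → suc l ≤ alongExtent o Y →
          RemovalStatement Y d k (Removed o Y l) (diagonalOf o l) (diagonalOf o (suc l))
removal o Y d k k≥1 l l< equal-count = equivalent , empty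
  where
  onDiagonal-count : ∀ l′ → diagCount Y (diagonalOf o l′) ≡ count Y (λ p → along o Y p ℕ.≟ l′ + across o Y p)
  onDiagonal-count l′ = count-cong Y (λ p → diag {Y} p ℤ.≟ diagonalOf o l′) (λ p → along o Y p ℕ.≟ l′ + across o Y p)
    (λ p → diag≡diagonalOf⇒ o Y l′) (λ p → diag≡diagonalOf⇐ o Y l′)

  open Removal o Y l l< (trans (sym (onDiagonal-count l)) (trans equal-count (onDiagonal-count (suc l))))

  diagPos≡i : diagPos Y (diagonalOf o l) ≡ i
  diagPos≡i = trans (cong (diagPos Y) (sym (diag≡diagonalOf⇐ o Y l Onℓ-p₁))) (diagPos-diag Y p₁)

  diagPos≡i′ : diagPos Y (diagonalOf o (suc l)) ≡ i′
  diagPos≡i′ = trans (cong (diagPos Y) (sym (diag≡diagonalOf⇐ o Y (suc l) Onℓ′-p₂))) (diagPos-diag Y p₂)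

  equivalent : dAt Y d (diagonalOf o l) ≡ dAt Y d (diagonalOf o (suc l)) → (μ : YD) → HasBoxes μ (Removed o Y l) →
               IntegrallyEquivalent Y μ (RestrictedOP Y k d) (RestrictedOP μ k (del d (diagPos Y (diagonalOf o l))))
  equivalent d-eq μ μ-boxes =
    subst (λ t → IntegrallyEquivalent Y μ (RestrictedOP Y k d) (RestrictedOP μ k (del d t))) (sym diagPos≡i)
      (ContractionProperties.integrallyEquivalent (Contracted.contraction μ oriented-boxes) k≥1 {d}
        (trans (cong (nth d) (sym diagPos≡i)) (trans d-eq (cong (nth d) diagPos≡i′))))
    where
    oriented-boxes : ∀ ab → (μ ∋⟨ o ⟩ ab) ⇔ RemovedBox o Y l ab
    oriented-boxes ab = ⇔-trans (μ-boxes (orient o ab)) (Removed⇔RemovedBox o Y l ab)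

  empty : dAt Y d (diagonalOf o (suc l)) < dAt Y d (diagonalOf o l) → Empty (RestrictedOP Y k d)
  empty lt x x∈P = ℕP.<⇒≱ (subst₂ _<_ (cong (nth d) diagPos≡i′) (cong (nth d) diagPos≡i) lt)
                          (DiagonalMatchingProperties.nth-≤ matching {k} {d} {x} x∈P)

+l+1≡+[1+l] : ∀ l → + l ℤ.+ + 1 ≡ + suc l
+l+1≡+[1+l] l = trans (sym (ℤP.pos-+ l 1)) (cong +_ (ℕP.+-comm l 1))

-l-1≡-[1+l] : ∀ l → ℤ.- + l ℤ.- + 1 ≡ ℤ.- + suc l
-l-1≡-[1+l] l = trans (lemma (+ l) (+ 1)) (cong ℤ.-_ (sym (ℤP.pos-+ 1 l)))
  where
  lemma : ∀ a b → ℤ.- a ℤ.- b ≡ ℤ.- (b ℤ.+ a)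
  lemma = solve-∀

-m≤-n⇒1+n≤m : ∀ {m n} → 1 ≤ m → ℤ.- + (m ∸ 1) ℤ.≤ ℤ.- + n → suc n ≤ m
-m≤-n⇒1+n≤m {m} {n} 1≤m le = subst (suc n ≤_) (trans (ℕP.+-comm 1 (m ∸ 1)) (ℕP.m∸n+n≡m 1≤m))
  (s≤s (ℤP.drop‿+≤+ (subst₂ ℤ._≤_ (ℤP.neg-involutive (+ n)) (ℤP.neg-involutive (+ (m ∸ 1))) (ℤP.neg-mono-≤ le))))

removal-ℓ≥0 : ∀ Y d k → 1 ≤ k → ∀ l → + l ℤ.≤ + (m₁ Y ∸ 1) →
              RemovalStatement Y d k (RemovedA Y (+ l)) (+ l) (+ l ℤ.+ + 1)
removal-ℓ≥0 Y d k k≥1 l l≤n₁ = subst (RemovalStatement Y d k (RemovedA Y (+ l)) (+ l)) (sym (+l+1≡+[1+l] l))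
  (removal byRows Y d k k≥1 l (s≤s (ℤP.drop‿+≤+ l≤n₁)))

removal-ℓ≤0 : ∀ Y d k → 1 ≤ k → ∀ l → ℤ.- + (m₂ Y ∸ 1) ℤ.≤ ℤ.- + l →
              RemovalStatement Y d k (RemovedB Y (ℤ.- + l)) (ℤ.- + l) (ℤ.- + l ℤ.- + 1)
removal-ℓ≤0 Y d k k≥1 l -m₂≤-l = subst (RemovalStatement Y d k (RemovedB Y (ℤ.- + l)) (ℤ.- + l)) (sym (-l-1≡-[1+l] l))
  (removal byColumns Y d k k≥1 l (-m≤-n⇒1+n≤m (pos Y Fin.zero) -m₂≤-l))

proposition5p3 :
    (Y : YD) (d : List ℕ) → length d ≡ m₁ Y + m₂ Y ∸ 1 → All (1 ≤_) d →
    (k : ℕ) → 1 ≤ k →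
    (ℓ : ℤ) → (ℤ.- (+ (m₂ Y ∸ 1))) ℤ.≤ ℓ → ℓ ℤ.≤ (+ (m₁ Y ∸ 1)) →
    -- case (a)
    ((+ 0 ℤ.≤ ℓ) → diagCount Y ℓ ≡ diagCount Y (ℓ ℤ.+ + 1) →
       (dAt Y d ℓ ≡ dAt Y d (ℓ ℤ.+ + 1) →
          (μ : YD) → HasBoxes μ (RemovedA Y ℓ) →
          IntegrallyEquivalent Y μ (RestrictedOP Y k d)
                                   (RestrictedOP μ k (del d (diagPos Y ℓ))))
       × (dAt Y d (ℓ ℤ.+ + 1) < dAt Y d ℓ → Empty (RestrictedOP Y k d)))
    ×
    -- case (b)
    ((ℓ ℤ.≤ + 0) → diagCount Y ℓ ≡ diagCount Y (ℓ ℤ.- + 1) →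
       (dAt Y d ℓ ≡ dAt Y d (ℓ ℤ.- + 1) →
          (μ : YD) → HasBoxes μ (RemovedB Y ℓ) →
          IntegrallyEquivalent Y μ (RestrictedOP Y k d)
                                   (RestrictedOP μ k (del d (diagPos Y ℓ))))
       × (dAt Y d (ℓ ℤ.- + 1) < dAt Y d ℓ → Empty (RestrictedOP Y k d)))
proposition5p3 Y d _ _ k k≥1 (+ l) -m₂≤ℓ ℓ≤n₁ =
  (λ _ → removal-ℓ≥0 Y d k k≥1 l ℓ≤n₁) , (λ { (ℤ.+≤+ z≤n) → removal-ℓ≤0 Y d k k≥1 0 -m₂≤ℓ })
proposition5p3 Y d _ _ k k≥1 -[1+ n ] -m₂≤ℓ _ =
  (λ ()) , (λ _ → removal-ℓ≤0 Y d k k≥1 (suc n) -m₂≤ℓ)
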